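{- Let $p\geq 4$ and let $G$ be the graph obtained from $C_p\,\square\,P_2$ by deleting the vertex $(u_0,v_1)$. Then $G$ admits an acyclic $T$-odd orientation for every subset $T\subseteq V(G)$ satisfying $\mathcal{P}$ if $p$ is odd, and for every subset $T\subseteq V(G)$ satisfying $\mathcal{P}$, $\mathcal{S}$ and $\overline{\mathcal{S}}$ if $p$ is even.
   Context: Graphs are finite and simple; $d(v)$ is degree. $C_p$ is the cycle $u_0u_1\cdots u_{p-1}u_0$, $P_2$ is the edge $v_0v_1$, and $C_p\square P_2$ has vertices $(u_i,v_j)$, adjacent iff equal in one coordinate and adjacent in the other factor. An orientation is $T$-odd if every vertex $v$ has odd in-degree iff $v\in T$; acyclic means no directed cycle. $Source(T)=V(G)\setminus T$, $Sink(T)=\{v\in T: d(v)\text{ odd}\}\cup\{v\notin T: d(v)\text{ even}\}$. $(\mathcal{P})$: $|E(G)|+|T|$ even. $(\mathcal{S})$: $Source(T)\neq\emptyset$ and if $|Source(T)|=1$ then $|V(G)|=1$ or $Source(T)\neq Sink(T)$. $(\overline{\mathcal{S}})$: $Sink(T)\neq\emptyset$ and if $|Sink(T)|=1$ then $|V(G)|=1$ or $Sink(T)\neq Source(T)$. -}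

module Defs where

open import Data.Nat using (ℕ; zero; suc; _+_; _≡ᵇ_; _<ᵇ_; _*_)
open import Data.Nat.Base using (_/_)
open import Data.Bool using (Bool; true; false; _∧_; _∨_; not; if_then_else_; T)
open import Data.Fin using (Fin; toℕ; zero; suc)
open import Data.List using (List; []; _∷_; filterᵇ; length; map; concatMap; allFin; cartesianProduct)
open import Data.List.Base using (mapMaybe)
open import Data.Maybe using (Maybe; just; nothing)
open import Data.Product using (Σ; _×_; _,_; proj₁; proj₂)
open import Data.Empty using (⊥)
open import Data.Sum using (_⊎_)
open import Relation.Binary.PropositionalEquality using (_≡_)
open import Relation.Nullary using (¬_)
open import Relation.Binary.Construct.Closure.Transitive using (TransClosure)
import Relation.Unary as U

record FinGraph : Set₁ where
  field
    V     : Set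
    verts : List V          -- every vertex exactly once
    adj   : V → V → Bool    -- symmetric, irreflexive

module _ (G : FinGraph) where
  open FinGraph G

  count : (V → Bool) → ℕ
  count P = length (filterᵇ P verts)

  nV : ℕ
  nV = length verts

  deg : V → ℕ
  deg v = count (adj v)

  nE : ℕ
  nE = length (filterᵇ (λ uv → adj (proj₁ uv) (proj₂ uv)) (cartesianProduct verts verts)) / 2

  -- An orientation: o u v = true means the edge uv is directed u → v.
  IsOrientation : (V → V → Bool) → Set
  IsOrientation o =
    (∀ u v → o u v ≡ true → adj u v ≡ true) ×
    (∀ u v → adj u v ≡ true → (o u v ≡ true × o v u ≡ false) ⊎ (o u v ≡ false × o v u ≡ true))

  indeg : (V → V → Bool) → V → ℕ
  indeg o v = count (λ u → o u v)

  isOdd : ℕ → Bool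
  isOdd zero = false
  isOdd (suc n) = not (isOdd n)

  -- T ⊆ V(G) given by its characteristic function
  TOdd : (V → Bool) → (V → V → Bool) → Set
  TOdd τ o = ∀ v → isOdd (indeg o v) ≡ τ v

  Acyclic : (V → V → Bool) → Set
  Acyclic o = ∀ v → ¬ TransClosure (λ a b → o a b ≡ true) v v

  AcyclicTOddOrientation : (V → Bool) → Set
  AcyclicTOddOrientation τ =
    Σ (V → V → Bool) λ o → IsOrientation o × TOdd τ o × Acyclic o

  Source : (V → Bool) → V → Bool
  Source τ v = not (τ v)

  Sink : (V → Bool) → V → Bool
  Sink τ v = (τ v ∧ isOdd (deg v)) ∨ (not (τ v) ∧ not (isOdd (deg v)))

  CondP : (V → Bool) → Set
  CondP τ = isOdd (nE + count τ) ≡ false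

  SameSet : (V → Bool) → (V → Bool) → Set
  SameSet A B = ∀ v → A v ≡ B v

  CondS : (V → Bool) → Set
  CondS τ = ¬ (count (Source τ) ≡ 0) ×
            (count (Source τ) ≡ 1 → nV ≡ 1 ⊎ ¬ SameSet (Source τ) (Sink τ))

  CondSbar : (V → Bool) → Set
  CondSbar τ = ¬ (count (Sink τ) ≡ 0) ×
               (count (Sink τ) ≡ 1 → nV ≡ 1 ⊎ ¬ SameSet (Sink τ) (Source τ))

-- C_p □ P_2 minus the vertex (u_0, v_1).
-- Vertex (u_i, v_j) is (i , j) with i : Fin p, j : Fin 2.

isZ : ∀ {n} → Fin n → Bool
isZ i = toℕ i ≡ᵇ 0

present : ∀ {p} → Fin p × Fin 2 → Bool
present (i , j) = not (isZ i ∧ (toℕ j ≡ᵇ 1))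

GV : ℕ → Set
GV p = Σ (Fin p × Fin 2) (λ x → T (present x))

cycAdj : (p : ℕ) → Fin p → Fin p → Bool
cycAdj p i k = step (toℕ i) (toℕ k) ∨ step (toℕ k) (toℕ i)
  where
    step : ℕ → ℕ → Bool
    step a b = (b ≡ᵇ suc a) ∨ ((b ≡ᵇ 0) ∧ (suc a ≡ᵇ p))

pathAdj : Fin 2 → Fin 2 → Bool
pathAdj j l = not (toℕ j ≡ᵇ toℕ l)

eqFin : ∀ {n} → Fin n → Fin n → Bool
eqFin i k = toℕ i ≡ᵇ toℕ k

boxAdj : (p : ℕ) → GV p → GV p → Bool
boxAdj p ((i , j) , _) ((k , l) , _) =
  (eqFin i k ∧ pathAdj j l) ∨ (eqFin j l ∧ cycAdj p i k)

GVlist : (p : ℕ) → List (GV p)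
GVlist p = mapMaybe keep (cartesianProduct (allFin p) (allFin 2))
  where
    keep : Fin p × Fin 2 → Maybe (GV p)
    keep x with present x in eq
    ... | true  = just (x , subst′ eq)
      where
        open import Relation.Binary.PropositionalEquality using (sym; subst)
        subst′ : present x ≡ true → T (present x)
        subst′ e = subst T (sym e) _
    ... | false = nothing

G12 : ℕ → FinGraph
G12 p = record { V = GV p ; verts = GVlist p ; adj = boxAdj p }

module Submission where

-- Write t₀, …, tₙ (n = p − 1) for the vertices (u_k, v₀) and b₁, …, bₙ for the vertices (u_k, v₁), so that G is
-- the ladder on the columns 1 … n closed into a cycle through t₀.  An acyclic orientation is read off a ranking of
-- the vertices (every edge points to the larger rank), so it suffices to rank the vertices such that every v has a
-- number of smaller neighbours of parity τ(v).  Ranks are laid down column by column: the parities at t_k and b_k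
-- dictate on which side of them t_{k+1} and b_{k+1} are ranked, and the relative order of t_{k+1} and b_{k+1} is
-- free unless the other choice would close a directed square.  Each free choice is spent on keeping the column after
-- next free, so every column can be handled except possibly the last, and the last one fails only at the end of a
-- chain of forced steps, which pins τ down two columns at a time.  The parity at the one vertex left over follows
-- from (P) by the handshake lemma.  If τ(t₀) is even, t₀ is made a source or a sink; otherwise t₀ is ranked next to
-- t₁ or next to tₙ at one end of the order, and if both attempts fail then p is even and T is either V(G) or the set
-- of vertices of degree 2, contradicting (S) or (S̄).

open import Defs
open import Algebra.Bundles using (CommutativeRing)
open import Data.Bool using (Bool; true; false; not; _∧_; _∨_; _xor_; if_then_else_)
open import Data.Bool.Properties
  using (xor-assoc; xor-comm; xor-same; xor-identityʳ; xor-inverseʳ; xor-annihilates-not; xor-∧-commutativeRing;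
         not-involutive; not-injective; not-distribˡ-xor; not-distribʳ-xor; ¬-not;
         ∧-zeroʳ; ∧-identityʳ; ∧-comm; ∧-distribˡ-xor; ∧-distribʳ-xor; ∧-conicalˡ; ∧-conicalʳ;
         ∨-zeroʳ; ∨-identityʳ; ∨-comm; T-irrelevant; T-≡)
import Data.Bool.Properties as Boolₚ
open import Data.Empty using (⊥; ⊥-elim)
open import Data.Fin using (Fin; zero; suc; toℕ; fromℕ<)
import Data.Fin.Properties as Finₚ
open import Data.Integer using (ℤ; +_; -[1+_]; ∣_∣; +<+; -<+; -<-) renaming (_<_ to _<ℤ_)
import Data.Integer.Properties as ℤ
open import Data.List
  using (List; []; _∷_; _++_; filterᵇ; length; map; foldr; mapMaybe; catMaybes; allFin; tabulate; cartesianProduct)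
open import Data.List.Properties using (map-++; map-∘; map-tabulate; map-cong)
open import Data.Maybe using (Maybe; just; nothing; maybe)
open import Data.Nat using (ℕ; zero; suc; _+_; _*_; _/_; _≤_; _<_; _≡ᵇ_; z≤n; s≤s)
open import Data.Nat.DivMod using (m*n/n≡m)
open import Data.Nat.Divisibility using (_∣_; _∣0; ∣-refl; ∣m∣n⇒∣m+n)
open import Data.Nat.ListAction using (sum)
open import Data.Nat.ListAction.Properties using (sum-++)
open import Data.Nat.Properties
  using (+-suc; +-identityʳ; *-comm; ≤-refl; ≤-trans; n≤1+n; m≤n⇒m≤1+n; m≤n⇒m<n∨m≡n; <⇒≢; <-irrefl; ≤∧≢⇒<;
         ≡ᵇ⇒≡; ≡⇒≡ᵇ)
import Data.Nat.Properties as ℕₚ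
open import Data.Product using (_×_; _,_; proj₁; proj₂)
open import Data.Product.Relation.Binary.Lex.Strict using (×-strictTotalOrder)
open import Data.Sum using (_⊎_; inj₁; inj₂; [_,_]′)
open import Data.Unit using (tt)
open import Relation.Binary.Bundles using (StrictTotalOrder)
open import Relation.Binary.Construct.Closure.Transitive using (TransClosure; [_]; _∷_)
open import Relation.Binary.PropositionalEquality
open import Relation.Nullary using (¬_)
open import Relation.Nullary.Decidable using (does; yes; no; dec-true; dec-false)
open import Relation.Nullary.Negation using (contradiction)
open import Function.Bundles using (Equivalence)
open import Algebra.Properties.CommutativeSemigroup
  (CommutativeRing.+-commutativeSemigroup xor-∧-commutativeRing) using () renaming (interchange to xor-interchange)
open ≡-Reasoning

dichotomy : ∀ b → b ≡ false ⊎ b ≡ true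
dichotomy false = inj₁ refl
dichotomy true  = inj₂ refl

if-true : ∀ {A : Set} {b} {x y : A} → b ≡ true → (if b then x else y) ≡ x
if-true refl = refl

if-false : ∀ {A : Set} {b} {x y : A} → b ≡ false → (if b then x else y) ≡ y
if-false refl = refl

≡ᵇ-refl : ∀ n → (n ≡ᵇ n) ≡ true
≡ᵇ-refl n = Equivalence.to T-≡ (≡⇒≡ᵇ n n refl)

≡ᵇ-true⇒≡ : ∀ {m n} → (m ≡ᵇ n) ≡ true → m ≡ n
≡ᵇ-true⇒≡ {m} {n} m≡ᵇn = ≡ᵇ⇒≡ m n (Equivalence.from T-≡ m≡ᵇn)

≡ᵇ-false⇒≢ : ∀ {m n} → (m ≡ᵇ n) ≡ false → m ≢ n
≡ᵇ-false⇒≢ {m} m≢ᵇn refl = contradiction (trans (sym (≡ᵇ-refl m)) m≢ᵇn) λ ()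

≢⇒≡ᵇ-false : ∀ {m n} → m ≢ n → (m ≡ᵇ n) ≡ false
≢⇒≡ᵇ-false m≢n = ¬-not (λ m≡ᵇn → m≢n (≡ᵇ-true⇒≡ m≡ᵇn))

≡ᵇ-sym : ∀ m n → (m ≡ᵇ n) ≡ (n ≡ᵇ m)
≡ᵇ-sym zero    zero    = refl
≡ᵇ-sym zero    (suc n) = refl
≡ᵇ-sym (suc m) zero    = refl
≡ᵇ-sym (suc m) (suc n) = ≡ᵇ-sym m n

-- Parities of counts

parityOf : {A : Set} → (A → Bool) → List A → Bool
parityOf P = foldr (λ x b → P x xor b) false

module _ {A : Set} where

  parityOf-cong : {P Q : A → Bool} → (∀ x → P x ≡ Q x) → ∀ xs → parityOf P xs ≡ parityOf Q xs
  parityOf-cong P≗Q []       = refl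
  parityOf-cong P≗Q (x ∷ xs) = cong₂ _xor_ (P≗Q x) (parityOf-cong P≗Q xs)

  parityOf-xor : (P Q : A → Bool) → ∀ xs →
                 parityOf (λ x → P x xor Q x) xs ≡ parityOf P xs xor parityOf Q xs
  parityOf-xor P Q []       = refl
  parityOf-xor P Q (x ∷ xs) = begin
    (P x xor Q x) xor parityOf (λ x → P x xor Q x) xs   ≡⟨ cong ((P x xor Q x) xor_) (parityOf-xor P Q xs) ⟩
    (P x xor Q x) xor (parityOf P xs xor parityOf Q xs) ≡⟨ xor-interchange (P x) (Q x) _ _ ⟩
    (P x xor parityOf P xs) xor (Q x xor parityOf Q xs) ∎

  parityOf-∧ʳ : (P : A → Bool) (d : Bool) → ∀ xs → parityOf (λ x → P x ∧ d) xs ≡ parityOf P xs ∧ d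
  parityOf-∧ʳ P d []       = refl
  parityOf-∧ʳ P d (x ∷ xs) = trans (cong ((P x ∧ d) xor_) (parityOf-∧ʳ P d xs))
                                   (sym (∧-distribʳ-xor d (P x) (parityOf P xs)))

parityOf-map : ∀ {A B : Set} (P : B → Bool) (f : A → B) xs → parityOf P (map f xs) ≡ parityOf (λ x → P (f x)) xs
parityOf-map P f []       = refl
parityOf-map P f (x ∷ xs) = cong (P (f x) xor_) (parityOf-map P f xs)

parityOf-++ : ∀ {A : Set} (P : A → Bool) → ∀ xs ys → parityOf P (xs ++ ys) ≡ parityOf P xs xor parityOf P ys
parityOf-++ P []       ys = refl
parityOf-++ P (x ∷ xs) ys = trans (cong (P x xor_) (parityOf-++ P xs ys)) (sym (xor-assoc (P x) _ _))

parityOf-mapMaybe : ∀ {A B : Set} (P : B → Bool) (f : A → Maybe B) xs →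
                    parityOf P (mapMaybe f xs) ≡ parityOf (λ x → maybe P false (f x)) xs
parityOf-mapMaybe P f []       = refl
parityOf-mapMaybe P f (x ∷ xs) with f x
... | just y  = cong (P y xor_) (parityOf-mapMaybe P f xs)
... | nothing = parityOf-mapMaybe P f xs

parityOf-cartesianProduct : ∀ {A B : Set} (P : A × B → Bool) xs ys →
  parityOf P (cartesianProduct xs ys) ≡ parityOf (λ x → parityOf (λ y → P (x , y)) ys) xs
parityOf-cartesianProduct P []       ys = refl
parityOf-cartesianProduct P (x ∷ xs) ys = begin
  parityOf P (map (x ,_) ys ++ cartesianProduct xs ys)
    ≡⟨ parityOf-++ P (map (x ,_) ys) _ ⟩
  parityOf P (map (x ,_) ys) xor parityOf P (cartesianProduct xs ys)
    ≡⟨ cong₂ _xor_ (parityOf-map P (x ,_) ys) (parityOf-cartesianProduct P xs ys) ⟩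
  parityOf (λ y → P (x , y)) ys xor parityOf (λ x → parityOf (λ y → P (x , y)) ys) xs ∎

parityBelow : ℕ → (ℕ → Bool) → Bool
parityBelow zero    f = false
parityBelow (suc p) f = f 0 xor parityBelow p (λ k → f (suc k))

parityOf-allFin : ∀ p (f : ℕ → Bool) → parityOf (λ i → f (toℕ i)) (allFin p) ≡ parityBelow p f
parityOf-allFin zero    f = refl
parityOf-allFin (suc p) f = cong (f 0 xor_) (begin
  parityOf (λ i → f (toℕ i)) (tabulate {n = p} suc)
    ≡⟨ cong (parityOf (λ i → f (toℕ i))) (sym (map-tabulate {n = p} (λ i → i) suc)) ⟩
  parityOf (λ i → f (toℕ i)) (map suc (allFin p))
    ≡⟨ parityOf-map (λ i → f (toℕ i)) suc (allFin p) ⟩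
  parityOf (λ i → f (suc (toℕ i))) (allFin p)
    ≡⟨ parityOf-allFin p (λ k → f (suc k)) ⟩
  parityBelow p (λ k → f (suc k)) ∎)

parityBelow-cong : ∀ p {f g : ℕ → Bool} → (∀ k → k < p → f k ≡ g k) → parityBelow p f ≡ parityBelow p g
parityBelow-cong zero    f≗g = refl
parityBelow-cong (suc p) f≗g = cong₂ _xor_ (f≗g 0 (s≤s z≤n)) (parityBelow-cong p (λ k k<p → f≗g (suc k) (s≤s k<p)))

parityBelow-xor : ∀ p (f g : ℕ → Bool) → parityBelow p (λ k → f k xor g k) ≡ parityBelow p f xor parityBelow p g
parityBelow-xor zero    f g = refl
parityBelow-xor (suc p) f g = begin
  (f 0 xor g 0) xor parityBelow p (λ k → f (suc k) xor g (suc k))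
    ≡⟨ cong ((f 0 xor g 0) xor_) (parityBelow-xor p (λ k → f (suc k)) (λ k → g (suc k))) ⟩
  (f 0 xor g 0) xor (parityBelow p (λ k → f (suc k)) xor parityBelow p (λ k → g (suc k)))
    ≡⟨ xor-interchange (f 0) (g 0) _ _ ⟩
  (f 0 xor parityBelow p (λ k → f (suc k))) xor (g 0 xor parityBelow p (λ k → g (suc k))) ∎

parityBelow-false : ∀ p → parityBelow p (λ _ → false) ≡ false
parityBelow-false zero    = refl
parityBelow-false (suc p) = parityBelow-false p

parityBelow-single : ∀ p t (w : ℕ → Bool) → t < p → parityBelow p (λ k → (k ≡ᵇ t) ∧ w k) ≡ w t
parityBelow-single (suc p) zero    w _         = trans (cong (w 0 xor_) (parityBelow-false p)) (xor-identityʳ (w 0))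
parityBelow-single (suc p) (suc t) w (s≤s t<p) = parityBelow-single p t (λ k → w (suc k)) t<p

parityBelow-three : ∀ {p t₁ t₂ t₃} {f₁ f₂ f₃ : ℕ → Bool} → t₁ < p → t₂ < p → t₃ < p →
  parityBelow p (λ k → ((k ≡ᵇ t₁) ∧ f₁ k) xor (((k ≡ᵇ t₂) ∧ f₂ k) xor ((k ≡ᵇ t₃) ∧ f₃ k))) ≡ f₁ t₁ xor f₂ t₂ xor f₃ t₃
parityBelow-three {p} {t₁} {t₂} {t₃} {f₁} {f₂} {f₃} t₁<p t₂<p t₃<p = begin
  parityBelow p (λ k → δ₁ k xor (δ₂ k xor δ₃ k))
    ≡⟨ parityBelow-xor p δ₁ (λ k → δ₂ k xor δ₃ k) ⟩
  parityBelow p δ₁ xor parityBelow p (λ k → δ₂ k xor δ₃ k)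
    ≡⟨ cong (parityBelow p δ₁ xor_) (parityBelow-xor p δ₂ δ₃) ⟩
  parityBelow p δ₁ xor (parityBelow p δ₂ xor parityBelow p δ₃)
    ≡⟨ cong₂ _xor_ (parityBelow-single p t₁ f₁ t₁<p)
                   (cong₂ _xor_ (parityBelow-single p t₂ f₂ t₂<p) (parityBelow-single p t₃ f₃ t₃<p)) ⟩
  f₁ t₁ xor f₂ t₂ xor f₃ t₃ ∎
  where
  δ₁ δ₂ δ₃ : ℕ → Bool
  δ₁ k = (k ≡ᵇ t₁) ∧ f₁ k
  δ₂ k = (k ≡ᵇ t₂) ∧ f₂ k
  δ₃ k = (k ≡ᵇ t₃) ∧ f₃ k

bit : Bool → ℕ
bit true  = 1
bit false = 0

module _ {A : Set} where

  length-filterᵇ : (P : A → Bool) → ∀ xs → length (filterᵇ P xs) ≡ sum (map (λ x → bit (P x)) xs)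
  length-filterᵇ P []       = refl
  length-filterᵇ P (x ∷ xs) with P x
  ... | true  = cong suc (length-filterᵇ P xs)
  ... | false = length-filterᵇ P xs

  sum-map-+ : (f g : A → ℕ) → ∀ xs → sum (map (λ x → f x + g x) xs) ≡ sum (map f xs) + sum (map g xs)
  sum-map-+ f g []       = refl
  sum-map-+ f g (x ∷ xs) = begin
    (f x + g x) + sum (map (λ x → f x + g x) xs) ≡⟨ cong (_+_ (f x + g x)) (sum-map-+ f g xs) ⟩
    (f x + g x) + (sum (map f xs) + sum (map g xs)) ≡⟨ +-interchange (f x) (g x) _ _ ⟩
    (f x + sum (map f xs)) + (g x + sum (map g xs)) ∎
    where open import Algebra.Properties.CommutativeSemigroup ℕₚ.+-commutativeSemigroup
            using () renaming (interchange to +-interchange)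

module _ {A B : Set} where

  sum-cartesianProduct : (f : A × B → ℕ) → ∀ xs ys →
    sum (map f (cartesianProduct xs ys)) ≡ sum (map (λ x → sum (map (λ y → f (x , y)) ys)) xs)
  sum-cartesianProduct f []       ys = refl
  sum-cartesianProduct f (x ∷ xs) ys = begin
    sum (map f (map (x ,_) ys ++ cartesianProduct xs ys))
      ≡⟨ cong sum (map-++ f (map (x ,_) ys) _) ⟩
    sum (map f (map (x ,_) ys) ++ map f (cartesianProduct xs ys))
      ≡⟨ sum-++ (map f (map (x ,_) ys)) _ ⟩
    sum (map f (map (x ,_) ys)) + sum (map f (cartesianProduct xs ys))
      ≡⟨ cong₂ _+_ (cong sum (sym (map-∘ ys))) (sum-cartesianProduct f xs ys) ⟩
    sum (map (λ y → f (x , y)) ys) + sum (map (λ x → sum (map (λ y → f (x , y)) ys)) xs) ∎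

  sum-exchange : (f : A → B → ℕ) → ∀ xs ys →
    sum (map (λ x → sum (map (f x) ys)) xs) ≡ sum (map (λ y → sum (map (λ x → f x y) xs)) ys)
  sum-exchange f []       ys = sym (sum-zeros ys)
    where
    sum-zeros : ∀ ys → sum (map (λ (_ : B) → 0) ys) ≡ 0
    sum-zeros []       = refl
    sum-zeros (_ ∷ ys) = sum-zeros ys
  sum-exchange f (x ∷ xs) ys = begin
    sum (map (f x) ys) + sum (map (λ x → sum (map (f x) ys)) xs)
      ≡⟨ cong (_+_ (sum (map (f x) ys))) (sum-exchange f xs ys) ⟩
    sum (map (f x) ys) + sum (map (λ y → sum (map (λ x → f x y) xs)) ys)
      ≡⟨ sum-map-+ (f x) (λ y → sum (map (λ x → f x y) xs)) ys ⟨
    sum (map (λ y → f x y + sum (map (λ x → f x y) xs)) ys) ∎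

-- Orientations of a finite graph

module _ (G : FinGraph) where
  open FinGraph G

  isOdd-+ : ∀ m n → isOdd G (m + n) ≡ isOdd G m xor isOdd G n
  isOdd-+ zero    n = refl
  isOdd-+ (suc m) n = trans (cong not (isOdd-+ m n)) (not-distribˡ-xor (isOdd G m) (isOdd G n))

  isOdd-sum : (f : V → ℕ) → ∀ xs → isOdd G (sum (map f xs)) ≡ parityOf (λ x → isOdd G (f x)) xs
  isOdd-sum f []       = refl
  isOdd-sum f (x ∷ xs) = trans (isOdd-+ (f x) _) (cong (isOdd G (f x) xor_) (isOdd-sum f xs))

  isOdd-count : (P : V → Bool) → isOdd G (count G P) ≡ parityOf P verts
  isOdd-count P = go verts
    where
    go : ∀ xs → isOdd G (length (filterᵇ P xs)) ≡ parityOf P xs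
    go []       = refl
    go (x ∷ xs) with P x
    ... | true  = cong not (go xs)
    ... | false = go xs

  count-false : (P : V → Bool) → (∀ v → P v ≡ false) → count G P ≡ 0
  count-false P never = go verts
    where
    go : ∀ xs → length (filterᵇ P xs) ≡ 0
    go []       = refl
    go (x ∷ xs) rewrite never x = go xs

  arcs : (V → V → Bool) → ℕ
  arcs R = sum (map (λ u → sum (map (λ v → bit (R u v)) verts)) verts)

  module _ {o : V → V → Bool} (isOrientation : IsOrientation G o)
           (adj-sym : ∀ u v → adj u v ≡ adj v u) where

    private
      no-arc : ∀ {u v} → adj u v ≡ false → o u v ≡ false
      no-arc {u} {v} ¬uv = ¬-not λ uv → contradiction (trans (sym ¬uv) (proj₁ isOrientation u v uv)) λ ()

      bit-adj : ∀ u v → bit (adj u v) ≡ bit (o u v) + bit (o v u)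
      bit-adj u v with adj u v in uv
      ... | false rewrite no-arc uv | no-arc (trans (adj-sym v u) uv) = refl
      ... | true with proj₂ isOrientation u v uv
      ...   | inj₁ (ouv , ovu) rewrite ouv | ovu = refl
      ...   | inj₂ (ouv , ovu) rewrite ouv | ovu = refl

      split-row : ∀ u → sum (map (λ v → bit (adj u v)) verts) ≡
                        sum (map (λ v → bit (o u v)) verts) + sum (map (λ v → bit (o v u)) verts)
      split-row u = trans (cong sum (map-cong (bit-adj u) verts)) (sum-map-+ _ _ verts)

    handshake : nE G ≡ sum (map (indeg G o) verts)
    handshake = begin
      length (filterᵇ (λ uv → adj (proj₁ uv) (proj₂ uv)) (cartesianProduct verts verts)) / 2
        ≡⟨ cong (_/ 2) (trans (length-filterᵇ _ (cartesianProduct verts verts))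
                               (sum-cartesianProduct (λ uv → bit (adj (proj₁ uv) (proj₂ uv))) verts verts)) ⟩
      arcs adj / 2
        ≡⟨ cong (_/ 2) (trans (cong sum (map-cong split-row verts)) (sum-map-+ _ _ verts)) ⟩
      (arcs o + arcs (λ u v → o v u)) / 2
        ≡⟨ cong (λ m → (arcs o + m) / 2) (sym (sum-exchange (λ v u → bit (o v u)) verts verts)) ⟩
      (arcs o + arcs o) / 2
        ≡⟨ cong (_/ 2) (trans (cong (_+_ (arcs o)) (sym (+-identityʳ (arcs o)))) (*-comm 2 (arcs o))) ⟩
      arcs o * 2 / 2
        ≡⟨ m*n/n≡m (arcs o) 2 ⟩
      arcs o
        ≡⟨ sum-exchange (λ u v → bit (o u v)) verts verts ⟩
      sum (map (λ v → sum (map (λ u → bit (o u v)) verts)) verts)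
        ≡⟨ cong sum (map-cong (λ v → sym (length-filterᵇ (λ u → o u v) verts)) verts) ⟩
      sum (map (indeg G o) verts) ∎

    parity-of-last-vertex : {τ : V → Bool} → CondP G τ →
      (chosen : V → Bool) → (∀ u v → chosen u ≡ true → chosen v ≡ true → u ≡ v) → parityOf chosen verts ≡ true →
      (∀ v → chosen v ≡ false → isOdd G (indeg G o v) ≡ τ v) → TOdd G τ o
    parity-of-last-vertex {τ} condP chosen unique chosen-odd elsewhere w with chosen w in ww
    ... | false = elsewhere w ww
    ... | true  = xor-cancel (isOdd G (indeg G o w)) (τ w) mismatch-w
      where
      mismatch : V → Bool
      mismatch v = isOdd G (indeg G o v) xor τ v

      mismatch-chosen : ∀ v → mismatch v ≡ chosen v ∧ mismatch w
      mismatch-chosen v with chosen v in wv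
      ... | false = trans (cong (_xor τ v) (elsewhere v wv)) (xor-same (τ v))
      ... | true rewrite unique v w wv ww = refl

      mismatch-w : mismatch w ≡ false
      mismatch-w = begin
        mismatch w
          ≡⟨ sym (cong (_∧ mismatch w) chosen-odd) ⟩
        parityOf chosen verts ∧ mismatch w
          ≡⟨ sym (parityOf-∧ʳ chosen (mismatch w) verts) ⟩
        parityOf (λ v → chosen v ∧ mismatch w) verts
          ≡⟨ sym (parityOf-cong mismatch-chosen verts) ⟩
        parityOf mismatch verts
          ≡⟨ parityOf-xor (λ v → isOdd G (indeg G o v)) τ verts ⟩
        parityOf (λ v → isOdd G (indeg G o v)) verts xor parityOf τ verts
          ≡⟨ cong₂ _xor_ (trans (sym (isOdd-sum (indeg G o) verts)) (cong (isOdd G) (sym handshake)))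
                         (sym (isOdd-count τ)) ⟩
        isOdd G (nE G) xor isOdd G (count G τ)
          ≡⟨ sym (isOdd-+ (nE G) (count G τ)) ⟩
        isOdd G (nE G + count G τ)
          ≡⟨ condP ⟩
        false ∎

      xor-cancel : ∀ a b → a xor b ≡ false → a ≡ b
      xor-cancel true  true  _ = refl
      xor-cancel false false _ = refl

module _ (G : FinGraph) {a ℓ₁ ℓ₂} (O : StrictTotalOrder a ℓ₁ ℓ₂) where
  open FinGraph G
  open StrictTotalOrder O using (asym; irrefl) renaming (Carrier to R; _<_ to _≺_; _<?_ to _≺?_; trans to ≺-trans)

  orientationBy : (V → R) → V → V → Bool
  orientationBy r u v = adj u v ∧ does (r u ≺? r v)

  module _ (r : V → R) where

    orientationBy-increasing : ∀ {u v} → orientationBy r u v ≡ true → r u ≺ r v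
    orientationBy-increasing {u} {v} uv with adj u v | r u ≺? r v
    ... | true | yes ru≺rv = ru≺rv

    orientationBy-acyclic : Acyclic G (orientationBy r)
    orientationBy-acyclic v cycle = irrefl (StrictTotalOrder.Eq.refl O) (increasing cycle)
      where
      increasing : ∀ {x y} → TransClosure (λ a b → orientationBy r a b ≡ true) x y → r x ≺ r y
      increasing [ xy ]    = orientationBy-increasing xy
      increasing (xy ∷ yz) = ≺-trans (orientationBy-increasing xy) (increasing yz)

    orientationBy-isOrientation : (∀ u v → adj u v ≡ adj v u) →
      (∀ u v → adj u v ≡ true → r u ≺ r v ⊎ r v ≺ r u) → IsOrientation G (orientationBy r)
    orientationBy-isOrientation adj-sym comparable = arc⇒edge , oriented
      where
      arc⇒edge : ∀ u v → orientationBy r u v ≡ true → adj u v ≡ true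
      arc⇒edge u v uv with adj u v
      ... | true = refl

      oriented : ∀ u v → adj u v ≡ true →
        (orientationBy r u v ≡ true × orientationBy r v u ≡ false) ⊎
        (orientationBy r u v ≡ false × orientationBy r v u ≡ true)
      oriented u v uv rewrite uv | trans (sym (adj-sym u v)) uv with comparable u v uv
      ... | inj₁ u≺v = inj₁ (dec-true (r u ≺? r v) u≺v , dec-false (r v ≺? r u) (asym u≺v))
      ... | inj₂ v≺u = inj₂ (dec-false (r u ≺? r v) (asym v≺u) , dec-true (r v ≺? r u) v≺u)

-- Ranks

-- Ranks are pairs of integers ordered lexicographically: a rank can always be placed directly next to an existing
-- one (same first coordinate, new extreme second coordinate) or beyond all ranks used so far (new extreme first one).
RankOrder : StrictTotalOrder _ _ _
RankOrder = ×-strictTotalOrder ℤ.<-strictTotalOrder ℤ.<-strictTotalOrder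

Rank : Set
Rank = StrictTotalOrder.Carrier RankOrder

open StrictTotalOrder RankOrder public using () renaming (_<_ to _<ʳ_; _<?_ to _<ʳ?_; asym to <ʳ-asym)

_<ʳᵇ_ : Rank → Rank → Bool
x <ʳᵇ y = does (x <ʳ? y)

Comparable : Rank → Rank → Set
Comparable x y = x <ʳ y ⊎ y <ʳ x

_<[_]_ : Rank → Bool → Rank → Set
x <[ true  ] y = x <ʳ y
x <[ false ] y = y <ʳ x

module _ {x y : Rank} where

  <[]-does : ∀ {b} → x <[ b ] y → x <ʳᵇ y ≡ b
  <[]-does {true}  x<y = dec-true (x <ʳ? y) x<y
  <[]-does {false} y<x = dec-false (x <ʳ? y) (<ʳ-asym y<x)

  <[]-flip : ∀ {b} → x <[ b ] y → y <[ not b ] x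
  <[]-flip {true}  x<y = x<y
  <[]-flip {false} y<x = y<x

  <[]-comparable : ∀ {b} → x <[ b ] y → Comparable x y
  <[]-comparable {true}  x<y = inj₁ x<y
  <[]-comparable {false} y<x = inj₂ y<x

extreme : Bool → ℕ → ℤ
extreme true  k = + suc k
extreme false k = -[1+ k ]

∣extreme∣ : ∀ b k → ∣ extreme b k ∣ ≡ suc k
∣extreme∣ true  k = refl
∣extreme∣ false k = refl

module _ {k : ℕ} where

  <-extreme : ∀ {x} → ∣ x ∣ ≤ k → x <ℤ extreme true k
  <-extreme {+ m}       m≤k = +<+ (s≤s m≤k)
  <-extreme { -[1+ m ]} _   = -<+

  extreme-< : ∀ {x} → ∣ x ∣ ≤ k → extreme false k <ℤ x
  extreme-< {+ m}       _   = -<+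
  extreme-< { -[1+ m ]} m<k = -<- m<k

  extreme-≢ : ∀ {x} b → ∣ x ∣ ≤ k → x ≢ extreme b k
  extreme-≢ true  x≤k refl = ℤ.<-irrefl refl (<-extreme x≤k)
  extreme-≢ false x≤k refl = ℤ.<-irrefl refl (extreme-< x≤k)

  to-extreme₁ : ∀ {x} b z → ∣ proj₁ x ∣ ≤ k → x <[ b ] (extreme b k , z)
  to-extreme₁ true  z x≤k = inj₁ (<-extreme x≤k)
  to-extreme₁ false z x≤k = inj₁ (extreme-< x≤k)

  to-extreme₂ : ∀ {x} b P → ∣ x ∣ ≤ k → (P , x) <[ b ] (P , extreme b k)
  to-extreme₂ true  P x≤k = inj₂ (refl , <-extreme x≤k)
  to-extreme₂ false P x≤k = inj₂ (refl , extreme-< x≤k)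

  from-extreme₁ : ∀ {x} b z → ∣ proj₁ x ∣ ≤ k → (extreme (not b) k , z) <[ b ] x
  from-extreme₁ true  z x≤k = inj₁ (extreme-< x≤k)
  from-extreme₁ false z x≤k = inj₁ (<-extreme x≤k)

  from-extreme₂ : ∀ {x} b P → ∣ x ∣ ≤ k → (P , extreme (not b) k) <[ b ] (P , x)
  from-extreme₂ true  P x≤k = inj₂ (refl , extreme-< x≤k)
  from-extreme₂ false P x≤k = inj₂ (refl , <-extreme x≤k)

Bounded : ℕ → Rank → Set
Bounded k (x , y) = ∣ x ∣ ≤ k × ∣ y ∣ ≤ k

bounded-mono : ∀ {k k′} r → k ≤ k′ → Bounded k r → Bounded k′ r
bounded-mono _ k≤k′ (x≤k , y≤k) = ≤-trans x≤k k≤k′ , ≤-trans y≤k k≤k′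

record Separated (k : ℕ) (a b : Rank) : Set where
  field
    bounded-a : Bounded k a
    bounded-b : Bounded k b
    apart     : proj₁ a ≢ proj₁ b

primary-decides : ∀ {x y} b s t → proj₁ x ≢ proj₁ y → x <[ b ] y → (proj₁ x , s) <[ b ] (proj₁ y , t)
primary-decides true  s t x≢y (inj₁ x<y)       = inj₁ x<y
primary-decides true  s t x≢y (inj₂ (x≡y , _)) = contradiction x≡y x≢y
primary-decides false s t x≢y (inj₁ y<x)       = inj₁ y<x
primary-decides false s t x≢y (inj₂ (y≡x , _)) = contradiction (sym y≡x) x≢y

record Placement (k : ℕ) (a b : Rank) (α β γ : Bool) : Set where
  field
    a′ b′       : Rank
    separated   : Separated (suc k) a′ b′
    top-step    : a <[ α ] a′
    bottom-step : b <[ β ] b′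
    rung        : b′ <[ γ ] a′

module _ {k : ℕ} where

  private
    ∣extreme∣≤ : ∀ b → ∣ extreme b k ∣ ≤ suc k
    ∣extreme∣≤ b rewrite ∣extreme∣ b k = ≤-refl

    third-case : ∀ α β γ γ′ → γ′ ≢ γ → γ′ ≢ α → (γ ≡ α → β ≡ not α → γ′ ≡ α) → γ′ ≡ not β
    third-case _     _     true  true  γ′≢γ _    _      = contradiction refl γ′≢γ
    third-case _     _     false false γ′≢γ _    _      = contradiction refl γ′≢γ
    third-case true  _     _     true  _    γ′≢α _      = contradiction refl γ′≢α
    third-case false _     _     false _    γ′≢α _      = contradiction refl γ′≢α
    third-case false false false true  _    _    _      = refl
    third-case false true  false true  _    _    forced = forced refl refl
    third-case true  true  true  false _    _    _      = refl
    third-case true  false true  false _    _    forced = forced refl refl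

  -- The hypothesis excludes the directed square a → a′ → b′ → b → a and its reverse, the only obstruction.
  place : ∀ {a b γ} → Separated k a b → b <[ γ ] a → (α β γ′ : Bool) →
          (γ ≡ α → β ≡ not α → γ′ ≡ α) → Placement k a b α β γ′
  place {a₁ , a₂} {b₁ , b₂} {γ} record { bounded-a = a₁≤ , a₂≤ ; bounded-b = b₁≤ , b₂≤ ; apart = apart }
        b<a α β γ′ forced with γ′ Boolₚ.≟ γ | γ′ Boolₚ.≟ α
  ... | yes refl | _ = record
    { a′ = a₁ , extreme α k ; b′ = b₁ , extreme β k
    ; separated = record { bounded-a = m≤n⇒m≤1+n a₁≤ , ∣extreme∣≤ α
                         ; bounded-b = m≤n⇒m≤1+n b₁≤ , ∣extreme∣≤ β
                         ; apart = apart }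
    ; top-step = to-extreme₂ α a₁ a₂≤ ; bottom-step = to-extreme₂ β b₁ b₂≤
    ; rung = primary-decides γ′ _ _ (λ e → apart (sym e)) b<a }
  ... | no _ | yes refl = record
    { a′ = extreme α k , + 0 ; b′ = b₁ , extreme β k
    ; separated = record { bounded-a = ∣extreme∣≤ α , z≤n
                         ; bounded-b = m≤n⇒m≤1+n b₁≤ , ∣extreme∣≤ β
                         ; apart = λ e → extreme-≢ α b₁≤ (sym e) }
    ; top-step = to-extreme₁ α (+ 0) a₁≤ ; bottom-step = to-extreme₂ β b₁ b₂≤
    ; rung = to-extreme₁ α (+ 0) b₁≤ }
  ... | no γ′≢γ | no γ′≢α rewrite third-case α β γ γ′ γ′≢γ γ′≢α forced = record
    { a′ = a₁ , extreme α k ; b′ = extreme β k , + 0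
    ; separated = record { bounded-a = m≤n⇒m≤1+n a₁≤ , ∣extreme∣≤ α
                         ; bounded-b = ∣extreme∣≤ β , z≤n
                         ; apart = extreme-≢ β a₁≤ }
    ; top-step = to-extreme₂ α a₁ a₂≤ ; bottom-step = to-extreme₁ β (+ 0) b₁≤
    ; rung = <[]-flip (to-extreme₁ β (+ 0) a₁≤) }

-- Scanning a ladder

-- A forced transition out of column j + 2 forces the one out of column j and equates the targets of columns j + 1
-- and j + 2; unwinding this down to column 0 leaves the following trace of the data.
ForcedChain : (xs ys : ℕ → Bool) (α₀ β₀ : Bool) → ℕ → Set
ForcedChain xs ys α₀ β₀ zero          = α₀ ≢ xs 0 × (xs 0 xor ys 0) xor (α₀ xor β₀) ≡ false
ForcedChain xs ys α₀ β₀ (suc zero)    = ⊥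
ForcedChain xs ys α₀ β₀ (suc (suc j)) =
  ForcedChain xs ys α₀ β₀ j × xs (suc j) ≡ xs (suc (suc j)) × ys (suc j) ≡ ys (suc (suc j))

module _ {xs ys : ℕ → Bool} {α₀ β₀ : Bool} where

  forcedChain-even : ∀ j → ForcedChain xs ys α₀ β₀ j → 2 ∣ j
  forcedChain-even zero          _           = _ ∣0
  forcedChain-even (suc (suc j)) (chain , _) = ∣m∣n⇒∣m+n ∣-refl (forcedChain-even j chain)

  forcedChain-start : ∀ j → ForcedChain xs ys α₀ β₀ j → ForcedChain xs ys α₀ β₀ 0
  forcedChain-start zero          start       = start
  forcedChain-start (suc (suc j)) (chain , _) = forcedChain-start j chain

interleave : ∀ {X Y : ℕ → Bool} {a₂ b₂ a₃ b₃ : Bool} j →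
  ForcedChain (λ k → X (suc (suc k))) (λ k → Y (suc (suc k))) a₂ b₂ j →
  ForcedChain (λ k → X (suc k)) (λ k → Y (suc k)) a₃ b₃ j →
  ∀ m → 1 ≤ m → m ≤ j → X (suc m) ≡ X (suc (suc m)) × Y (suc m) ≡ Y (suc (suc m))
interleave zero _ _ (suc m) _ ()
interleave {X} {Y} (suc (suc j)) (chain₂ , pair₂) (chain₃ , pair₃) m 1≤m m≤j+2 with m≤n⇒m<n∨m≡n m≤j+2
... | inj₂ refl = pair₂
... | inj₁ (s≤s m≤j+1) with m≤n⇒m<n∨m≡n m≤j+1
...   | inj₂ refl          = pair₃
...   | inj₁ (s≤s m≤j)     = interleave {X} {Y} j chain₂ chain₃ m 1≤m m≤j

record Column : Set where
  constructor column
  field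
    α β γ : Bool

record RungAt (k : ℕ) (g : Bool) : Set where
  field
    top bottom : Rank
    separated  : Separated (suc k) top bottom
    oriented   : bottom <[ g ] top

initialRung : ∀ g → RungAt 0 g
initialRung true  = record { top = + 1 , + 0 ; bottom = -[1+ 0 ] , + 0
                           ; separated = record { bounded-a = ≤-refl , z≤n ; bounded-b = ≤-refl , z≤n
                                                ; apart = λ () }
                           ; oriented = inj₁ -<+ }
initialRung false = record { top = -[1+ 0 ] , + 0 ; bottom = + 1 , + 0
                           ; separated = record { bounded-a = ≤-refl , z≤n ; bounded-b = ≤-refl , z≤n
                                                ; apart = λ () }
                           ; oriented = inj₁ -<+ }

-- Column k of the scan records α = [t_{k-1} < t_k], β = [b_{k-1} < b_k] and γ = [b_k < t_k] (α₀ and β₀ describe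
-- the edges entering column 0).  The target parities xs k and ys k at t_k and b_k fix α and β of column k + 1.  Its
-- γ must equal the previous one when `forced` holds, is chosen by `final` in the last column L + 1, and is otherwise
-- chosen by `balance` so that column k + 2 has α = xs, which keeps the transition out of column k + 2 free.
module LadderScan (xs ys : ℕ → Bool) (α₀ β₀ : Bool) (L : ℕ) (final : Bool → Bool → Bool) where

  nextα : ℕ → Column → Bool
  nextα k c = not (xs k xor Column.α c xor Column.γ c)

  nextβ : ℕ → Column → Bool
  nextβ k c = not (ys k xor Column.β c xor not (Column.γ c))

  forced : ℕ → Column → Bool
  forced k c = (nextα k c xor nextβ k c) ∧ (xs k xor Column.α c)

  balance : ℕ → Bool → Bool
  balance j a = xs j xor a xor not (xs (suc j))

  nextγ : ℕ → Column → Bool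
  nextγ k c = if forced k c then Column.γ c
              else if k ≡ᵇ L then final (nextα k c) (nextβ k c)
              else balance (suc k) (nextα k c)

  scan : ℕ → Column
  scan zero    = column α₀ β₀ (balance 0 α₀)
  scan (suc k) = column (nextα k (scan k)) (nextβ k (scan k)) (nextγ k (scan k))

  α β γ : ℕ → Bool
  α k = Column.α (scan k)
  β k = Column.β (scan k)
  γ k = Column.γ (scan k)

  Forced : ℕ → Set
  Forced k = forced k (scan k) ≡ true

  private
    bottom-identity : ∀ x a g → g xor a xor not (not (x xor a xor g)) ≡ x
    bottom-identity true  true  true  = refl
    bottom-identity true  true  false = refl
    bottom-identity true  false true  = refl
    bottom-identity true  false false = refl
    bottom-identity false true  true  = refl
    bottom-identity false true  false = refl
    bottom-identity false false true  = refl
    bottom-identity false false false = refl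

    top-identity : ∀ x a g → a xor not (not (x xor a xor g)) xor g ≡ x
    top-identity true  true  true  = refl
    top-identity true  true  false = refl
    top-identity true  false true  = refl
    top-identity true  false false = refl
    top-identity false true  true  = refl
    top-identity false true  false = refl
    top-identity false false true  = refl
    top-identity false false false = refl

    balanced-next : ∀ x a y → not (x xor a xor (x xor a xor not y)) ≡ y
    balanced-next true  true  true  = refl
    balanced-next true  true  false = refl
    balanced-next true  false true  = refl
    balanced-next true  false false = refl
    balanced-next false true  true  = refl
    balanced-next false true  false = refl
    balanced-next false false true  = refl
    balanced-next false false false = refl

    unbalanced-rung : ∀ x a g → x xor a ≡ true → g ≡ not (x xor a xor g)
    unbalanced-rung true  false true  _ = refl
    unbalanced-rung true  false false _ = refl
    unbalanced-rung false true  true  _ = refl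
    unbalanced-rung false true  false _ = refl

    rung-unbalanced : ∀ x a g → g ≡ not (x xor a xor g) → x xor a ≡ true
    rung-unbalanced true  true  true  ()
    rung-unbalanced true  true  false ()
    rung-unbalanced true  false g     _ = refl
    rung-unbalanced false true  g     _ = refl
    rung-unbalanced false false true  ()
    rung-unbalanced false false false ()

  top-parity : ∀ k → α k xor not (α (suc k)) xor γ k ≡ xs k
  top-parity k = top-identity (xs k) (α k) (γ k)

  bottom-parity : ∀ k → not (γ k) xor β k xor not (β (suc k)) ≡ ys k
  bottom-parity k = bottom-identity (ys k) (β k) (not (γ k))

  forced-rung : ∀ {k} → Forced k → γ (suc k) ≡ γ k
  forced-rung f = if-true f

  forced-differ : ∀ {k} → Forced k → α (suc k) xor β (suc k) ≡ true
  forced-differ {k} f = ∧-conicalˡ (α (suc k) xor β (suc k)) (xs k xor α k) f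

  forced-unbalanced : ∀ {k} → Forced k → xs k xor α k ≡ true
  forced-unbalanced {k} f = ∧-conicalʳ (α (suc k) xor β (suc k)) (xs k xor α k) f

  forced-rung≡α : ∀ {k} → Forced k → γ (suc k) ≡ α (suc k)
  forced-rung≡α {k} f = trans (forced-rung f) (unbalanced-rung (xs k) (α k) (γ k) (forced-unbalanced f))

  balanced-unforced : ∀ {k} → α k ≡ xs k → forced k (scan k) ≡ false
  balanced-unforced {k} bal rewrite bal | xor-same (xs k) = ∧-zeroʳ _

  admissible : ∀ k → γ k ≡ α (suc k) → β (suc k) ≡ not (α (suc k)) → γ (suc k) ≡ α (suc k)
  admissible k γ≡α β≡¬α = trans (forced-rung f) γ≡α
    where
    f : Forced k
    f = cong₂ _∧_ (trans (cong (α (suc k) xor_) β≡¬α) (xor-inverseʳ (α (suc k))))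
                  (rung-unbalanced (xs k) (α k) (γ k) γ≡α)

  unforced-balances : ∀ {k} → forced k (scan k) ≡ false → k ≢ L → α (suc (suc k)) ≡ xs (suc (suc k))
  unforced-balances {k} f k≢L =
    trans (cong (λ g → not (xs (suc k) xor α (suc k) xor g))
                (trans (if-false f) (if-false (≢⇒≡ᵇ-false k≢L))))
          (balanced-next (xs (suc k)) (α (suc k)) (xs (suc (suc k))))

  balanced-at-1 : α 1 ≡ xs 1
  balanced-at-1 = balanced-next (xs 0) α₀ (xs 1)

  final-rung : forced L (scan L) ≡ false → γ (suc L) ≡ final (α (suc L)) (β (suc L))
  final-rung f = trans (if-false f) (if-true (≡ᵇ-refl L))

  differ : ℕ → Bool
  differ k = α k xor β k

  differ-suc : ∀ k → differ (suc k) ≡ not ((xs k xor ys k) xor differ k)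
  differ-suc k = begin
    not (x xor a xor g) xor not (y xor b xor not g) ≡⟨ xor-annihilates-not (x xor a xor g) _ ⟩
    (x xor (a xor g)) xor (y xor (b xor not g))     ≡⟨ xor-interchange x (a xor g) y _ ⟩
    (x xor y) xor ((a xor g) xor (b xor not g))     ≡⟨ cong ((x xor y) xor_) (xor-interchange a g b (not g)) ⟩
    (x xor y) xor ((a xor b) xor (g xor not g))     ≡⟨ cong (λ t → (x xor y) xor ((a xor b) xor t)) (xor-inverseʳ g) ⟩
    (x xor y) xor ((a xor b) xor true)              ≡⟨ cong ((x xor y) xor_) (xor-comm (a xor b) true) ⟩
    (x xor y) xor not (a xor b)                     ≡⟨ not-distribʳ-xor (x xor y) (a xor b) ⟨
    not ((x xor y) xor (a xor b))                   ∎
    where x = xs k; y = ys k; a = α k; b = β k; g = γ k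

  private
    not≡true : ∀ {x} → not x ≡ true → x ≡ false
    not≡true {false} _ = refl

    pair-top : ∀ x₁ x₂ a → x₂ xor not (x₁ xor a xor a) ≡ true → x₁ ≡ x₂
    pair-top true  true  true  _ = refl
    pair-top true  true  false _ = refl
    pair-top false false true  _ = refl
    pair-top false false false _ = refl

    pair-bottom : ∀ x y₁ y₂ → not ((x xor y₂) xor not ((x xor y₁) xor true)) ≡ true → y₁ ≡ y₂
    pair-bottom true  true  true  _ = refl
    pair-bottom true  false false _ = refl
    pair-bottom false true  true  _ = refl
    pair-bottom false false false _ = refl

  backtrack : ∀ j → j ≤ L → Forced j → ForcedChain xs ys α₀ β₀ j
  backtrack zero _ f =
    (λ α₀≡xs₀ → contradiction (trans (sym f) (balanced-unforced α₀≡xs₀)) λ ()) ,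
    not≡true (trans (sym (differ-suc 0)) (forced-differ f))
  backtrack (suc zero) _ f = contradiction (trans (sym f) (balanced-unforced balanced-at-1)) λ ()
  backtrack (suc (suc j)) j+2≤L f = backtrack j (≤-trans (n≤1+n j) (≤-trans (n≤1+n (suc j)) j+2≤L)) fj ,
                                    xs-pair , ys-pair
    where
    fj : Forced j
    fj = ¬-not λ unforced → contradiction
      (trans (sym f) (balanced-unforced (unforced-balances unforced (<⇒≢ (≤-trans (n≤1+n (suc j)) j+2≤L))))) λ ()
    xs-pair : xs (suc j) ≡ xs (suc (suc j))
    xs-pair = pair-top (xs (suc j)) (xs (suc (suc j))) (α (suc j))
                (trans (cong (λ g → xs (suc (suc j)) xor not (xs (suc j) xor α (suc j) xor g)) (sym (forced-rung≡α fj)))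
                       (forced-unbalanced f))
    ys-pair : ys (suc j) ≡ ys (suc (suc j))
    ys-pair = pair-bottom (xs (suc (suc j))) (ys (suc j)) (ys (suc (suc j)))
                (trans (cong₂ (λ x d → not ((xs (suc (suc j)) xor ys (suc (suc j))) xor not ((x xor ys (suc j)) xor d)))
                              (sym xs-pair) (sym (forced-differ fj)))
                (trans (cong (λ d → not ((xs (suc (suc j)) xor ys (suc (suc j))) xor d)) (sym (differ-suc (suc j))))
                (trans (sym (differ-suc (suc (suc j)))) (forced-differ f))))

  opaque
    rung : ∀ k → RungAt k (γ k)
    placement : ∀ k → Placement (suc k) (RungAt.top (rung k)) (RungAt.bottom (rung k)) (α (suc k)) (β (suc k)) (γ (suc k))

    rung zero    = initialRung (γ 0)
    rung (suc k) = record { top = a′ ; bottom = b′ ; separated = separated ; oriented = Placement.rung (placement k) }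
      where open Placement (placement k)

    placement k = place (RungAt.separated (rung k)) (RungAt.oriented (rung k)) (α (suc k)) (β (suc k)) (γ (suc k))
                        (admissible k)

    A B : ℕ → Rank
    A k = RungAt.top (rung k)
    B k = RungAt.bottom (rung k)

    A-step : ∀ k → A k <[ α (suc k) ] A (suc k)
    A-step k = Placement.top-step (placement k)

    B-step : ∀ k → B k <[ β (suc k) ] B (suc k)
    B-step k = Placement.bottom-step (placement k)

    B<[γ]A : ∀ k → B k <[ γ k ] A k
    B<[γ]A k = RungAt.oriented (rung k)

    A-bounded : ∀ k → Bounded (suc k) (A k)
    A-bounded k = Separated.bounded-a (RungAt.separated (rung k))

    B-bounded : ∀ k → Bounded (suc k) (B k)
    B-bounded k = Separated.bounded-b (RungAt.separated (rung k))

  last-rung : γ (suc L) ≡ final (α (suc L)) (β (suc L)) ⊎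
              ForcedChain xs ys α₀ β₀ L × γ (suc L) ≡ α (suc L) × β (suc L) ≡ not (α (suc L))
  last-rung with dichotomy (forced L (scan L))
  ... | inj₁ unforced = inj₁ (final-rung unforced)
  ... | inj₂ f        = inj₂ (backtrack L ≤-refl f , forced-rung≡α f , differ-true (forced-differ f))
    where
    differ-true : ∀ {a b} → a xor b ≡ true → b ≡ not a
    differ-true {true}  {false} _ = refl
    differ-true {false} {true}  _ = refl

-- The graph in coordinates

vertexAt : ∀ {p} → Fin p × Fin 2 → Maybe (GV p)
vertexAt (zero  , zero)     = just ((zero , zero) , tt)
vertexAt (suc i , zero)     = just ((suc i , zero) , tt)
vertexAt (zero  , suc zero) = nothing
vertexAt (suc i , suc zero) = just ((suc i , suc zero) , tt)

GVlist≡ : ∀ p → GVlist p ≡ mapMaybe vertexAt (cartesianProduct (allFin p) (allFin 2))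
GVlist≡ p = cong catMaybes (map-cong (λ { (zero , zero) → refl ; (suc i , zero) → refl
                                         ; (zero , suc zero) → refl ; (suc i , suc zero) → refl })
                                      (cartesianProduct (allFin p) (allFin 2)))

-- Vertex (k , 0) is t_k = (u_k, v₀) and (k , 1) is b_k = (u_k, v₁); prv and nxt are the cyclic neighbours of a
-- column and nz k tells whether column k has a bottom vertex.
module Coordinates (m : ℕ) where

  n : ℕ
  n = suc (suc m)

  Vertex : Set
  Vertex = GV (suc n)

  col : Vertex → ℕ
  col v = toℕ (proj₁ (proj₁ v))

  row : Vertex → Fin 2
  row v = proj₂ (proj₁ v)

  nz : ℕ → Bool
  nz k = not (k ≡ᵇ 0)

  col-bottom : ∀ i pf → 1 ≤ col ((i , suc zero) , pf)
  col-bottom (suc i) _ = s≤s z≤n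

  col≤n : ∀ u → col u ≤ n
  col≤n u = ℕₚ.≤-pred (Finₚ.toℕ<n (proj₁ (proj₁ u)))

  nz-pos : ∀ {j} → 1 ≤ j → nz j ≡ true
  nz-pos (s≤s z≤n) = refl

  prv : ℕ → ℕ
  prv zero    = n
  prv (suc k) = k

  nxt : ℕ → ℕ
  nxt k = if k ≡ᵇ n then 0 else suc k

  prv≤n : ∀ k → k ≤ n → prv k ≤ n
  prv≤n zero    _     = ≤-refl
  prv≤n (suc k) k+1≤n = ≤-trans (n≤1+n k) k+1≤n

  nxt≤n : ∀ k → k ≤ n → nxt k ≤ n
  nxt≤n k k≤n with dichotomy (k ≡ᵇ n)
  ... | inj₂ k≡ᵇn rewrite k≡ᵇn = z≤n
  ... | inj₁ k≢ᵇn rewrite k≢ᵇn = ≤∧≢⇒< k≤n (≡ᵇ-false⇒≢ k≢ᵇn)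

  nxt-below : ∀ j → j < n → nxt j ≡ suc j
  nxt-below j j<n = if-false (≢⇒≡ᵇ-false {j} {n} (λ { refl → <-irrefl refl j<n }))

  nxt-last : nxt n ≡ 0
  nxt-last = if-true (≡ᵇ-refl n)

  nxt-prv : ∀ k → k ≤ n → nxt (prv k) ≡ k
  nxt-prv zero    _     = if-true (≡ᵇ-refl n)
  nxt-prv (suc k) k+1≤n = if-false (≢⇒≡ᵇ-false {k} {n} (λ { refl → <-irrefl refl k+1≤n }))

  nxt≡suc : ∀ k → k ≤ n → nxt k ≢ 0 → k < n × nxt k ≡ suc k
  nxt≡suc k k≤n nxt≢0 with dichotomy (k ≡ᵇ n)
  ... | inj₂ k≡ᵇn = contradiction (if-true k≡ᵇn) nxt≢0
  ... | inj₁ k≢ᵇn = ≤∧≢⇒< k≤n (≡ᵇ-false⇒≢ k≢ᵇn) , if-false k≢ᵇn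

  private
    step : ℕ → ℕ → Bool
    step a b = (b ≡ᵇ suc a) ∨ ((b ≡ᵇ 0) ∧ (suc a ≡ᵇ suc n))

  adjAt : ℕ → Fin 2 → ℕ → Fin 2 → Bool
  adjAt k l k₀ l₀ = ((k ≡ᵇ k₀) ∧ not (toℕ l ≡ᵇ toℕ l₀)) ∨ ((toℕ l ≡ᵇ toℕ l₀) ∧ (step k k₀ ∨ step k₀ k))

  private
    step-prv : ∀ a b → step a b ≡ (a ≡ᵇ prv b)
    step-prv a zero    = refl
    step-prv a (suc b) = trans (∨-identityʳ (b ≡ᵇ a)) (≡ᵇ-sym b a)

    step-nxt : ∀ a b → a ≤ n → step b a ≡ (a ≡ᵇ nxt b)
    step-nxt a b a≤n with dichotomy (b ≡ᵇ n)
    ... | inj₁ b≢ᵇn rewrite b≢ᵇn | ∧-zeroʳ (a ≡ᵇ 0) = ∨-identityʳ _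
    ... | inj₂ b≡ᵇn with ≡ᵇ-true⇒≡ {b} {n} b≡ᵇn
    ...   | refl rewrite ≡ᵇ-refl b | ∧-identityʳ (a ≡ᵇ 0)
                       | ≢⇒≡ᵇ-false {a} {suc b} (λ { refl → <-irrefl refl a≤n }) = refl

    ∨⇒xor : ∀ a b → a ∧ b ≡ false → a ∨ b ≡ a xor b
    ∨⇒xor true  false _ = refl
    ∨⇒xor false b     _ = refl

  cycle-adjacent : ∀ k k₀ → k ≤ n → step k k₀ ∨ step k₀ k ≡ (k ≡ᵇ prv k₀) ∨ (k ≡ᵇ nxt k₀)
  cycle-adjacent k k₀ k≤n = cong₂ _∨_ (step-prv k k₀) (step-nxt k k₀ k≤n)

  prv≢nxt : ∀ k → prv k ≢ nxt k
  prv≢nxt zero ()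
  prv≢nxt (suc k) k≡nxt with dichotomy (suc k ≡ᵇ n)
  ... | inj₁ k+1≢ᵇn = contradiction (trans k≡nxt (if-false k+1≢ᵇn)) λ ()
  ... | inj₂ k+1≡ᵇn with ≡ᵇ-true⇒≡ {suc k} {n} k+1≡ᵇn | trans k≡nxt (if-true k+1≡ᵇn)
  ...   | () | refl

  adj-sym : ∀ u v → boxAdj (suc n) u v ≡ boxAdj (suc n) v u
  adj-sym u v = cong₂ _∨_
    (cong₂ _∧_ (≡ᵇ-sym (col u) (col v)) (cong not (≡ᵇ-sym (toℕ (row u)) (toℕ (row v)))))
    (cong₂ _∧_ (≡ᵇ-sym (toℕ (row u)) (toℕ (row v))) (∨-comm (step (col u) (col v)) (step (col v) (col u))))

  private
    cycle-cases : ∀ {a b} → a ≤ n → ((a ≡ᵇ b) ∧ false) ∨ (step a b ∨ step b a) ≡ true → a ≡ prv b ⊎ a ≡ nxt b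
    cycle-cases {a} {b} a≤n adj rewrite ∧-zeroʳ (a ≡ᵇ b) | cycle-adjacent a b a≤n with a ≡ᵇ prv b in e
    ... | true  = inj₁ (≡ᵇ-true⇒≡ e)
    ... | false = inj₂ (≡ᵇ-true⇒≡ adj)

    rung-case : ∀ {a b} → ((a ≡ᵇ b) ∧ true) ∨ false ≡ true → a ≡ b
    rung-case {a} {b} adj rewrite ∨-identityʳ ((a ≡ᵇ b) ∧ true) | ∧-identityʳ (a ≡ᵇ b) = ≡ᵇ-true⇒≡ adj

  adjacent-cases : ∀ u v → boxAdj (suc n) u v ≡ true →
    (row u ≡ row v × (col u ≡ prv (col v) ⊎ col u ≡ nxt (col v))) ⊎ (col u ≡ col v × row u ≢ row v)
  adjacent-cases u@((i , zero) , _) ((k , zero) , _) uv = inj₁ (refl , cycle-cases (col≤n u) uv)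
  adjacent-cases u@((i , suc zero) , _) ((k , suc zero) , _) uv = inj₁ (refl , cycle-cases (col≤n u) uv)
  adjacent-cases ((i , zero) , _) ((k , suc zero) , _) uv = inj₂ (rung-case uv , λ ())
  adjacent-cases ((i , suc zero) , _) ((k , zero) , _) uv = inj₂ (rung-case uv , λ ())

  column-parity : (F : ℕ → Fin 2 → Bool) →
    parityOf (λ u → F (col u) (row u)) (GVlist (suc n)) ≡ parityBelow (suc n) (λ k → F k zero xor (nz k ∧ F k (suc zero)))
  column-parity F = begin
    parityOf Q (GVlist (suc n))
      ≡⟨ cong (parityOf Q) (GVlist≡ (suc n)) ⟩
    parityOf Q (mapMaybe vertexAt (cartesianProduct (allFin (suc n)) (allFin 2)))
      ≡⟨ parityOf-mapMaybe Q vertexAt (cartesianProduct (allFin (suc n)) (allFin 2)) ⟩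
    parityOf (λ x → maybe Q false (vertexAt x)) (cartesianProduct (allFin (suc n)) (allFin 2))
      ≡⟨ parityOf-cartesianProduct (λ x → maybe Q false (vertexAt x)) (allFin (suc n)) (allFin 2) ⟩
    parityOf (λ i → maybe Q false (vertexAt (i , zero)) xor (maybe Q false (vertexAt (i , suc zero)) xor false)) (allFin (suc n))
      ≡⟨ parityOf-cong cell (allFin (suc n)) ⟩
    parityOf (λ i → G (toℕ i)) (allFin (suc n))
      ≡⟨ parityOf-allFin (suc n) G ⟩
    parityBelow (suc n) G ∎
    where
    Q : Vertex → Bool
    Q u = F (col u) (row u)
    G : ℕ → Bool
    G k = F k zero xor (nz k ∧ F k (suc zero))
    cell : ∀ i → maybe Q false (vertexAt (i , zero)) xor (maybe Q false (vertexAt (i , suc zero)) xor false) ≡ G (toℕ i)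
    cell zero    = refl
    cell (suc i) = cong (F (suc (toℕ i)) zero xor_) (xor-identityʳ _)

  private
    ∧-left-swap : ∀ x y z → x ∧ (y ∧ z) ≡ y ∧ (x ∧ z)
    ∧-left-swap true  y z = refl
    ∧-left-swap false y z = sym (∧-zeroʳ y)

    top-cell : ∀ a b e z w₀ w₁ → a ∧ b ≡ false →
      (((e ∧ false) ∨ (a ∨ b)) ∧ w₀) xor (z ∧ (((e ∧ true) ∨ false) ∧ w₁)) ≡
      (a ∧ w₀) xor ((b ∧ w₀) xor (e ∧ (z ∧ w₁)))
    top-cell a b e z w₀ w₁ disjoint = begin
      (((e ∧ false) ∨ (a ∨ b)) ∧ w₀) xor (z ∧ (((e ∧ true) ∨ false) ∧ w₁))
        ≡⟨ cong₂ (λ x y → ((x ∨ (a ∨ b)) ∧ w₀) xor (z ∧ (y ∧ w₁)))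
                 (∧-zeroʳ e) (trans (∨-identityʳ (e ∧ true)) (∧-identityʳ e)) ⟩
      ((a ∨ b) ∧ w₀) xor (z ∧ (e ∧ w₁))
        ≡⟨ cong₂ (λ x y → (x ∧ w₀) xor y) (∨⇒xor a b disjoint) (∧-left-swap z e w₁) ⟩
      ((a xor b) ∧ w₀) xor (e ∧ (z ∧ w₁))
        ≡⟨ cong (_xor (e ∧ (z ∧ w₁))) (∧-distribʳ-xor w₀ a b) ⟩
      ((a ∧ w₀) xor (b ∧ w₀)) xor (e ∧ (z ∧ w₁))
        ≡⟨ xor-assoc (a ∧ w₀) (b ∧ w₀) _ ⟩
      (a ∧ w₀) xor ((b ∧ w₀) xor (e ∧ (z ∧ w₁))) ∎

    bottom-cell : ∀ a b e z w₀ w₁ → a ∧ b ≡ false →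
      (((e ∧ true) ∨ false) ∧ w₀) xor (z ∧ (((e ∧ false) ∨ (a ∨ b)) ∧ w₁)) ≡
      (e ∧ w₀) xor ((a ∧ (z ∧ w₁)) xor (b ∧ (z ∧ w₁)))
    bottom-cell a b e z w₀ w₁ disjoint = begin
      (((e ∧ true) ∨ false) ∧ w₀) xor (z ∧ (((e ∧ false) ∨ (a ∨ b)) ∧ w₁))
        ≡⟨ cong₂ (λ x y → (x ∧ w₀) xor (z ∧ ((y ∨ (a ∨ b)) ∧ w₁)))
                 (trans (∨-identityʳ (e ∧ true)) (∧-identityʳ e)) (∧-zeroʳ e) ⟩
      (e ∧ w₀) xor (z ∧ ((a ∨ b) ∧ w₁))
        ≡⟨ cong (λ x → (e ∧ w₀) xor (z ∧ (x ∧ w₁))) (∨⇒xor a b disjoint) ⟩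
      (e ∧ w₀) xor (z ∧ ((a xor b) ∧ w₁))
        ≡⟨ cong (λ x → (e ∧ w₀) xor (z ∧ x)) (∧-distribʳ-xor w₁ a b) ⟩
      (e ∧ w₀) xor (z ∧ ((a ∧ w₁) xor (b ∧ w₁)))
        ≡⟨ cong ((e ∧ w₀) xor_) (∧-distribˡ-xor z (a ∧ w₁) (b ∧ w₁)) ⟩
      (e ∧ w₀) xor ((z ∧ (a ∧ w₁)) xor (z ∧ (b ∧ w₁)))
        ≡⟨ cong₂ (λ x y → (e ∧ w₀) xor (x xor y)) (∧-left-swap z a w₁) (∧-left-swap z b w₁) ⟩
      (e ∧ w₀) xor ((a ∧ (z ∧ w₁)) xor (b ∧ (z ∧ w₁))) ∎

    prv-nxt-disjoint : ∀ k k₀ → (k ≡ᵇ prv k₀) ∧ (k ≡ᵇ nxt k₀) ≡ false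
    prv-nxt-disjoint k k₀ with dichotomy (k ≡ᵇ prv k₀)
    ... | inj₁ k≢ᵇprv rewrite k≢ᵇprv = refl
    ... | inj₂ k≡ᵇprv rewrite k≡ᵇprv | ≡ᵇ-true⇒≡ {k} {prv k₀} k≡ᵇprv = ≢⇒≡ᵇ-false (prv≢nxt k₀)

  top-neighbours : ∀ i pf (W : ℕ → Fin 2 → Bool) →
    parityOf (λ u → boxAdj (suc n) u ((i , zero) , pf) ∧ W (col u) (row u)) (GVlist (suc n)) ≡
    W (prv (toℕ i)) zero xor W (nxt (toℕ i)) zero xor (nz (toℕ i) ∧ W (toℕ i) (suc zero))
  top-neighbours i pf W = begin
    parityOf (λ u → adjAt (col u) (row u) k₀ zero ∧ W (col u) (row u)) (GVlist (suc n))
      ≡⟨ column-parity (λ k l → adjAt k l k₀ zero ∧ W k l) ⟩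
    parityBelow (suc n) (λ k → (adjAt k zero k₀ zero ∧ W k zero) xor (nz k ∧ (adjAt k (suc zero) k₀ zero ∧ W k (suc zero))))
      ≡⟨ parityBelow-cong (suc n) cell ⟩
    parityBelow (suc n) (λ k → ((k ≡ᵇ prv k₀) ∧ W k zero) xor (((k ≡ᵇ nxt k₀) ∧ W k zero) xor ((k ≡ᵇ k₀) ∧ (nz k ∧ W k (suc zero)))))
      ≡⟨ parityBelow-three {f₁ = λ k → W k zero} {λ k → W k zero} {λ k → nz k ∧ W k (suc zero)}
                           (s≤s (prv≤n k₀ k₀≤n)) (s≤s (nxt≤n k₀ k₀≤n)) (s≤s k₀≤n) ⟩
    W (prv k₀) zero xor W (nxt k₀) zero xor (nz k₀ ∧ W k₀ (suc zero)) ∎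
    where
    k₀ = toℕ i
    k₀≤n : k₀ ≤ n
    k₀≤n = ℕₚ.≤-pred (Finₚ.toℕ<n i)
    cell : ∀ k → k < suc n →
      (adjAt k zero k₀ zero ∧ W k zero) xor (nz k ∧ (adjAt k (suc zero) k₀ zero ∧ W k (suc zero))) ≡
      ((k ≡ᵇ prv k₀) ∧ W k zero) xor (((k ≡ᵇ nxt k₀) ∧ W k zero) xor ((k ≡ᵇ k₀) ∧ (nz k ∧ W k (suc zero))))
    cell k (s≤s k≤n) = trans
      (cong (λ c → ((((k ≡ᵇ k₀) ∧ false) ∨ c) ∧ W k zero) xor (nz k ∧ ((((k ≡ᵇ k₀) ∧ true) ∨ false) ∧ W k (suc zero))))
            (cycle-adjacent k k₀ k≤n))
      (top-cell (k ≡ᵇ prv k₀) (k ≡ᵇ nxt k₀) (k ≡ᵇ k₀) (nz k) (W k zero) (W k (suc zero)) (prv-nxt-disjoint k k₀))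

  bottom-neighbours : ∀ i pf (W : ℕ → Fin 2 → Bool) →
    parityOf (λ u → boxAdj (suc n) u ((i , suc zero) , pf) ∧ W (col u) (row u)) (GVlist (suc n)) ≡
    W (toℕ i) zero xor (nz (prv (toℕ i)) ∧ W (prv (toℕ i)) (suc zero)) xor (nz (nxt (toℕ i)) ∧ W (nxt (toℕ i)) (suc zero))
  bottom-neighbours i pf W = begin
    parityOf (λ u → adjAt (col u) (row u) k₀ (suc zero) ∧ W (col u) (row u)) (GVlist (suc n))
      ≡⟨ column-parity (λ k l → adjAt k l k₀ (suc zero) ∧ W k l) ⟩
    parityBelow (suc n) (λ k → (adjAt k zero k₀ (suc zero) ∧ W k zero) xor
                               (nz k ∧ (adjAt k (suc zero) k₀ (suc zero) ∧ W k (suc zero))))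
      ≡⟨ parityBelow-cong (suc n) cell ⟩
    parityBelow (suc n) (λ k → ((k ≡ᵇ k₀) ∧ W k zero) xor
                               (((k ≡ᵇ prv k₀) ∧ (nz k ∧ W k (suc zero))) xor ((k ≡ᵇ nxt k₀) ∧ (nz k ∧ W k (suc zero)))))
      ≡⟨ parityBelow-three {f₁ = λ k → W k zero} {λ k → nz k ∧ W k (suc zero)} {λ k → nz k ∧ W k (suc zero)}
                           (s≤s k₀≤n) (s≤s (prv≤n k₀ k₀≤n)) (s≤s (nxt≤n k₀ k₀≤n)) ⟩
    W k₀ zero xor (nz (prv k₀) ∧ W (prv k₀) (suc zero)) xor (nz (nxt k₀) ∧ W (nxt k₀) (suc zero)) ∎
    where
    k₀ = toℕ i
    k₀≤n : k₀ ≤ n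
    k₀≤n = ℕₚ.≤-pred (Finₚ.toℕ<n i)
    cell : ∀ k → k < suc n →
      (adjAt k zero k₀ (suc zero) ∧ W k zero) xor (nz k ∧ (adjAt k (suc zero) k₀ (suc zero) ∧ W k (suc zero))) ≡
      ((k ≡ᵇ k₀) ∧ W k zero) xor (((k ≡ᵇ prv k₀) ∧ (nz k ∧ W k (suc zero))) xor ((k ≡ᵇ nxt k₀) ∧ (nz k ∧ W k (suc zero))))
    cell k (s≤s k≤n) = trans
      (cong (λ c → ((((k ≡ᵇ k₀) ∧ true) ∨ false) ∧ W k zero) xor (nz k ∧ ((((k ≡ᵇ k₀) ∧ false) ∨ c) ∧ W k (suc zero))))
            (cycle-adjacent k k₀ k≤n))
      (bottom-cell (k ≡ᵇ prv k₀) (k ≡ᵇ nxt k₀) (k ≡ᵇ k₀) (nz k) (W k zero) (W k (suc zero)) (prv-nxt-disjoint k k₀))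

  private
    degree-parity : ∀ v → isOdd (G12 (suc n)) (deg (G12 (suc n)) v) ≡
                    parityOf (λ u → boxAdj (suc n) u v ∧ true) (GVlist (suc n))
    degree-parity v = trans (isOdd-count (G12 (suc n)) (boxAdj (suc n) v))
                            (parityOf-cong (λ u → trans (adj-sym v u) (sym (∧-identityʳ _))) (GVlist (suc n)))

  top-degree : ∀ i pf → isOdd (G12 (suc n)) (deg (G12 (suc n)) ((i , zero) , pf)) ≡ nz (toℕ i)
  top-degree i pf = trans (degree-parity ((i , zero) , pf))
                          (trans (top-neighbours i pf (λ _ _ → true))
                                 (trans (not-involutive _) (∧-identityʳ (nz (toℕ i)))))

  bottom-degree : ∀ i pf → isOdd (G12 (suc n)) (deg (G12 (suc n)) ((i , suc zero) , pf)) ≡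
                  true xor nz (prv (toℕ i)) xor nz (nxt (toℕ i))
  bottom-degree i pf = trans (degree-parity ((i , suc zero) , pf))
                             (trans (bottom-neighbours i pf (λ _ _ → true))
                                    (cong₂ (λ x y → true xor x xor y) (∧-identityʳ (nz (prv (toℕ i))))
                                                                      (∧-identityʳ (nz (nxt (toℕ i))))))

  vertex-≡ : ∀ {u v : Vertex} → col u ≡ col v → row u ≡ row v → u ≡ v
  vertex-≡ {(i , l) , t} {(i′ , l′) , t′} c r with Finₚ.toℕ-injective c | r
  ... | refl | refl = cong ((i , l) ,_) (T-irrelevant t t′)

  at : ℕ → Fin 2 → Vertex → Bool
  at c l u = (col u ≡ᵇ c) ∧ does (row u Finₚ.≟ l)

  at-unique : ∀ {c l} u v → at c l u ≡ true → at c l v ≡ true → u ≡ v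
  at-unique {c} {l} u v atu atv = vertex-≡ (trans (col≡ u atu) (sym (col≡ v atv))) (trans (row≡ u atu) (sym (row≡ v atv)))
    where
    col≡ : ∀ w → at c l w ≡ true → col w ≡ c
    col≡ w e with col w ≡ᵇ c in cw
    ... | true = ≡ᵇ-true⇒≡ cw
    row≡ : ∀ w → at c l w ≡ true → row w ≡ l
    row≡ w e with col w ≡ᵇ c | row w Finₚ.≟ l
    ... | true | yes r = r

  at-parity : ∀ l → parityOf (at n l) (GVlist (suc n)) ≡ true
  at-parity zero = begin
    parityOf (at n zero) (GVlist (suc n))
      ≡⟨ column-parity (λ k l → (k ≡ᵇ n) ∧ does (l Finₚ.≟ zero)) ⟩
    parityBelow (suc n) (λ k → ((k ≡ᵇ n) ∧ true) xor (nz k ∧ ((k ≡ᵇ n) ∧ false)))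
      ≡⟨ parityBelow-cong (suc n) {g = λ k → (k ≡ᵇ n) ∧ true} (λ k _ →
           trans (cong (((k ≡ᵇ n) ∧ true) xor_) (trans (cong (nz k ∧_) (∧-zeroʳ (k ≡ᵇ n))) (∧-zeroʳ (nz k))))
                 (xor-identityʳ _)) ⟩
    parityBelow (suc n) (λ k → (k ≡ᵇ n) ∧ true)
      ≡⟨ parityBelow-single (suc n) n (λ _ → true) ≤-refl ⟩
    true ∎
  at-parity (suc zero) = begin
    parityOf (at n (suc zero)) (GVlist (suc n))
      ≡⟨ column-parity (λ k l → (k ≡ᵇ n) ∧ does (l Finₚ.≟ suc zero)) ⟩
    parityBelow (suc n) (λ k → ((k ≡ᵇ n) ∧ false) xor (nz k ∧ ((k ≡ᵇ n) ∧ true)))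
      ≡⟨ parityBelow-cong (suc n) {g = λ k → (k ≡ᵇ n) ∧ nz k} (λ k _ → cong₂ _xor_ (∧-zeroʳ (k ≡ᵇ n))
                                                     (trans (cong (nz k ∧_) (∧-identityʳ (k ≡ᵇ n))) (∧-comm (nz k) _))) ⟩
    parityBelow (suc n) (λ k → (k ≡ᵇ n) ∧ nz k)
      ≡⟨ parityBelow-single (suc n) n nz ≤-refl ⟩
    true ∎

  private
    onVertices : (Vertex → Bool) → Fin (suc n) → Fin 2 → Bool
    onVertices τ zero    zero       = τ ((zero , zero) , tt)
    onVertices τ (suc i) zero       = τ ((suc i , zero) , tt)
    onVertices τ zero    (suc zero) = false
    onVertices τ (suc i) (suc zero) = τ ((suc i , suc zero) , tt)

    onVertices-correct : ∀ τ u → τ u ≡ onVertices τ (proj₁ (proj₁ u)) (row u)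
    onVertices-correct τ ((zero  , zero)     , _) = refl
    onVertices-correct τ ((suc i , zero)     , _) = refl
    onVertices-correct τ ((zero  , suc zero) , ())
    onVertices-correct τ ((suc i , suc zero) , _) = refl

  -- Junk value false at coordinates that are not a vertex.
  byCoordinates : (Vertex → Bool) → ℕ → Fin 2 → Bool
  byCoordinates τ k l with k ℕₚ.<? suc n
  ... | yes k<p = onVertices τ (fromℕ< k<p) l
  ... | no  _   = false

  byCoordinates-correct : ∀ τ u → τ u ≡ byCoordinates τ (col u) (row u)
  byCoordinates-correct τ u with col u ℕₚ.<? suc n
  ... | yes k<p rewrite Finₚ.fromℕ<-toℕ (proj₁ (proj₁ u)) k<p = onVertices-correct τ u
  ... | no  k≮p = contradiction (Finₚ.toℕ<n (proj₁ (proj₁ u))) k≮p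

-- Rankings column by column

module Solutions (m : ℕ) where
  open Coordinates m

  topIn : (A B : ℕ → Rank) → ℕ → Bool
  topIn A B j = (A (prv j) <ʳᵇ A j) xor (A (nxt j) <ʳᵇ A j) xor (nz j ∧ (B j <ʳᵇ A j))

  bottomIn : (A B : ℕ → Rank) → ℕ → Bool
  bottomIn A B j = (A j <ʳᵇ B j) xor (nz (prv j) ∧ (B (prv j) <ʳᵇ B j)) xor (nz (nxt j) ∧ (B (nxt j) <ʳᵇ B j))

  -- Ranks A k of t_k and B k of b_k satisfying every parity equation except possibly one in the last column;
  -- that one then holds by (P).
  record Solution (X Y : ℕ → Bool) : Set where
    field
      A B               : ℕ → Rank
      top-comparable    : ∀ j → j ≤ n → Comparable (A j) (A (nxt j))
      rung-comparable   : ∀ j → 1 ≤ j → j ≤ n → Comparable (A j) (B j)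
      bottom-comparable : ∀ j → 1 ≤ j → j < n → Comparable (B j) (B (suc j))
      top-parity        : ∀ j → j < n → topIn A B j ≡ X j
      bottom-parity     : ∀ j → 1 ≤ j → j < n → bottomIn A B j ≡ Y j
      last-column       : topIn A B n ≡ X n ⊎ bottomIn A B n ≡ Y n

  module _ (τ : Vertex → Bool) (condP : CondP (G12 (suc n)) τ)
           (sol : Solution (λ k → byCoordinates τ k zero) (λ k → byCoordinates τ k (suc zero))) where
    open Solution sol

    private
      G : FinGraph
      G = G12 (suc n)

      R : ℕ → Fin 2 → Rank
      R k zero       = A k
      R k (suc zero) = B k

      rank : Vertex → Rank
      rank u = R (col u) (row u)

      o : Vertex → Vertex → Bool
      o = orientationBy G RankOrder rank

      swap : ∀ {x y} → Comparable x y → Comparable y x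
      swap (inj₁ x<y) = inj₂ x<y
      swap (inj₂ y<x) = inj₁ y<x

      top-pair : ∀ a b → b ≤ n → a ≡ prv b ⊎ a ≡ nxt b → Comparable (A a) (A b)
      top-pair _ b b≤n (inj₁ refl) = subst (λ c → Comparable (A (prv b)) (A c)) (nxt-prv b b≤n)
                                           (top-comparable (prv b) (prv≤n b b≤n))
      top-pair _ b b≤n (inj₂ refl) = swap (top-comparable b b≤n)

      bottom-pair : ∀ a b → 1 ≤ a → 1 ≤ b → b ≤ n → a ≡ prv b ⊎ a ≡ nxt b → Comparable (B a) (B b)
      bottom-pair _ (suc b) 1≤a _ b+1≤n (inj₁ refl) = bottom-comparable b 1≤a b+1≤n
      bottom-pair a b 1≤a 1≤b b≤n (inj₂ a≡nxt)
        with nxt≡suc b b≤n (λ nxt≡0 → contradiction (subst (1 ≤_) (trans a≡nxt nxt≡0) 1≤a) λ ())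
      ... | b<n , nxt≡suc rewrite a≡nxt | nxt≡suc = swap (bottom-comparable b 1≤b b<n)

      comparable : ∀ u v → boxAdj (suc n) u v ≡ true → Comparable (rank u) (rank v)
      comparable u v uv with adjacent-cases u v uv
      comparable ((i , zero) , _) v@((k , zero) , _) _ | inj₁ (_ , adj) = top-pair (toℕ i) (toℕ k) (col≤n v) adj
      comparable ((i , suc zero) , pu) v@((k , suc zero) , pv) _ | inj₁ (_ , adj) =
        bottom-pair (toℕ i) (toℕ k) (col-bottom i pu) (col-bottom k pv) (col≤n v) adj
      comparable ((i , zero) , _) v@((k , suc zero) , pv) _ | inj₂ (i≡k , _) rewrite i≡k =
        rung-comparable (toℕ k) (col-bottom k pv) (col≤n v)
      comparable u@((i , suc zero) , pu) ((k , zero) , _) _ | inj₂ (i≡k , _) =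
        swap (subst (λ c → Comparable (A c) (B (toℕ i))) i≡k (rung-comparable (toℕ i) (col-bottom i pu) (col≤n u)))
      comparable ((i , zero) , _) ((k , suc zero) , _) _ | inj₁ (() , _)
      comparable ((i , suc zero) , _) ((k , zero) , _) _ | inj₁ (() , _)
      comparable ((i , zero) , _) ((k , zero) , _) _ | inj₂ (_ , r≢r) = contradiction refl r≢r
      comparable ((i , suc zero) , _) ((k , suc zero) , _) _ | inj₂ (_ , r≢r) = contradiction refl r≢r

      X Y : ℕ → Bool
      X k = byCoordinates τ k zero
      Y k = byCoordinates τ k (suc zero)

      top-vertex : ∀ i pf → isOdd G (indeg G o ((i , zero) , pf)) ≡ topIn A B (toℕ i)
      top-vertex i pf = trans (isOdd-count G (λ u → o u ((i , zero) , pf)))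
                              (top-neighbours i pf (λ k l → R k l <ʳᵇ A (toℕ i)))

      bottom-vertex : ∀ i pf → isOdd G (indeg G o ((i , suc zero) , pf)) ≡ bottomIn A B (toℕ i)
      bottom-vertex i pf = trans (isOdd-count G (λ u → o u ((i , suc zero) , pf)))
                                 (bottom-neighbours i pf (λ k l → R k l <ʳᵇ B (toℕ i)))

      top-ok : ∀ i pf → (toℕ i ≡ n → topIn A B n ≡ X n) → isOdd G (indeg G o ((i , zero) , pf)) ≡ τ ((i , zero) , pf)
      top-ok i pf at-n = trans (top-vertex i pf) (trans equation (sym (byCoordinates-correct τ ((i , zero) , pf))))
        where
        equation : topIn A B (toℕ i) ≡ X (toℕ i)
        equation with m≤n⇒m<n∨m≡n (col≤n ((i , zero) , pf))
        ... | inj₁ i<n = top-parity (toℕ i) i<n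
        ... | inj₂ i≡n rewrite i≡n = at-n refl

      bottom-ok : ∀ i pf → (toℕ i ≡ n → bottomIn A B n ≡ Y n) →
                  isOdd G (indeg G o ((i , suc zero) , pf)) ≡ τ ((i , suc zero) , pf)
      bottom-ok i pf at-n = trans (bottom-vertex i pf) (trans equation (sym (byCoordinates-correct τ ((i , suc zero) , pf))))
        where
        equation : bottomIn A B (toℕ i) ≡ Y (toℕ i)
        equation with m≤n⇒m<n∨m≡n (col≤n ((i , suc zero) , pf))
        ... | inj₁ i<n = bottom-parity (toℕ i) (col-bottom i pf) i<n
        ... | inj₂ i≡n rewrite i≡n = at-n refl

      at-self : ∀ v → col v ≡ n → at n (row v) v ≡ true
      at-self v col≡n rewrite col≡n | ≡ᵇ-refl n = dec-true (row v Finₚ.≟ row v) refl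

      isOrientation : IsOrientation G o
      isOrientation = orientationBy-isOrientation G RankOrder rank adj-sym comparable

      t-odd : TOdd G τ o
      t-odd with last-column
      ... | inj₁ top-n = parity-of-last-vertex G isOrientation adj-sym condP (at n (suc zero)) at-unique
                                               (at-parity (suc zero)) elsewhere
        where
        elsewhere : ∀ v → at n (suc zero) v ≡ false → isOdd G (indeg G o v) ≡ τ v
        elsewhere ((i , zero) , pf)     _   = top-ok i pf (λ _ → top-n)
        elsewhere v@((i , suc zero) , pf) ¬at = bottom-ok i pf (λ i≡n → contradiction (trans (sym (at-self v i≡n)) ¬at) λ ())
      ... | inj₂ bottom-n = parity-of-last-vertex G isOrientation adj-sym condP (at n zero) at-unique
                                                  (at-parity zero) elsewhere
        where
        elsewhere : ∀ v → at n zero v ≡ false → isOdd G (indeg G o v) ≡ τ v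
        elsewhere v@((i , zero) , pf)   ¬at = top-ok i pf (λ i≡n → contradiction (trans (sym (at-self v i≡n)) ¬at) λ ())
        elsewhere ((i , suc zero) , pf) _   = bottom-ok i pf (λ _ → bottom-n)

    solution-orientation : AcyclicTOddOrientation G τ
    solution-orientation = o , isOrientation , t-odd , orientationBy-acyclic G RankOrder rank

-- A scan laid on the graph columns s, …, s + L + 1, next to given ranks for the columns before s.
module Embedding (m : ℕ) (X Y : ℕ → Bool)
                 (s : ℕ) (α₀ β₀ : Bool) (L : ℕ) (final : Bool → Bool → Bool) where
  open Coordinates m
  open Solutions m
  open LadderScan (λ k → X (s + k)) (λ k → Y (s + k)) α₀ β₀ L final public renaming (A to Aˢ; B to Bˢ)

  module Within (1≤s : 1 ≤ s) (fits : s + suc L ≤ n) where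

    scan-bounded : ∀ k → k ≤ suc L → Bounded n (Aˢ k) × Bounded n (Bˢ k)
    scan-bounded k k≤ = bounded-mono (Aˢ k) k+1≤n (A-bounded k) , bounded-mono (Bˢ k) k+1≤n (B-bounded k)
      where
      k+1≤n : suc k ≤ n
      k+1≤n = ≤-trans (s≤s k≤) (≤-trans (ℕₚ.+-monoˡ-≤ (suc L) 1≤s) fits)

    module Interior (A B : ℕ → Rank)
            (A-at : ∀ k → k ≤ suc L → A (s + k) ≡ Aˢ k) (B-at : ∀ k → k ≤ suc L → B (s + k) ≡ Bˢ k)
            (left-top : (A (prv s) <ʳᵇ A s) ≡ α₀) (left-bottom : (nz (prv s) ∧ (B (prv s) <ʳᵇ B s)) ≡ β₀) where

      private
        prv-at : ∀ k → prv (s + suc k) ≡ s + k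
        prv-at k = cong prv (+-suc s k)

        nz-at : ∀ k → nz (s + k) ≡ true
        nz-at k = nz-pos (≤-trans 1≤s (ℕₚ.m≤m+n s k))

        nxt-at : ∀ k → k ≤ L → nxt (s + k) ≡ s + suc k
        nxt-at k k≤L = trans (nxt-below (s + k) (≤-trans (ℕₚ.+-monoʳ-< s (s≤s k≤L)) fits))
                             (sym (+-suc s k))

        A-next : ∀ k → k ≤ L → A (suc (s + k)) ≡ Aˢ (suc k)
        A-next k k≤L = trans (cong A (sym (+-suc s k))) (A-at (suc k) (s≤s k≤L))

        B-next : ∀ k → k ≤ L → B (suc (s + k)) ≡ Bˢ (suc k)
        B-next k k≤L = trans (cong B (sym (+-suc s k))) (B-at (suc k) (s≤s k≤L))

        ≤suc : ∀ {k} → k ≤ L → k ≤ suc L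
        ≤suc = ℕₚ.m≤n⇒m≤1+n

      top-left : ∀ k → k ≤ suc L → (A (prv (s + k)) <ʳᵇ A (s + k)) ≡ α k
      top-left zero _ = subst (λ j → (A (prv j) <ʳᵇ A j) ≡ α₀) (sym (+-identityʳ s)) left-top
      top-left (suc k) (s≤s k≤L) = begin
        A (prv (s + suc k)) <ʳᵇ A (s + suc k) ≡⟨ cong₂ (λ i j → A i <ʳᵇ A j) (prv-at k) (+-suc s k) ⟩
        A (s + k) <ʳᵇ A (suc (s + k))         ≡⟨ cong₂ _<ʳᵇ_ (A-at k (≤suc k≤L)) (A-next k k≤L) ⟩
        Aˢ k <ʳᵇ Aˢ (suc k)                   ≡⟨ <[]-does (A-step k) ⟩
        α (suc k)                             ∎

      top-right : ∀ k → k ≤ L → (A (nxt (s + k)) <ʳᵇ A (s + k)) ≡ not (α (suc k))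
      top-right k k≤L = begin
        A (nxt (s + k)) <ʳᵇ A (s + k) ≡⟨ cong₂ (λ i j → A i <ʳᵇ A j) (trans (nxt-at k k≤L) (+-suc s k)) refl ⟩
        A (suc (s + k)) <ʳᵇ A (s + k) ≡⟨ cong₂ _<ʳᵇ_ (A-next k k≤L) (A-at k (≤suc k≤L)) ⟩
        Aˢ (suc k) <ʳᵇ Aˢ k           ≡⟨ <[]-does (<[]-flip (A-step k)) ⟩
        not (α (suc k))               ∎

      top-rung : ∀ k → k ≤ suc L → (nz (s + k) ∧ (B (s + k) <ʳᵇ A (s + k))) ≡ γ k
      top-rung k k≤ = begin
        nz (s + k) ∧ (B (s + k) <ʳᵇ A (s + k)) ≡⟨ cong₂ (λ z r → z ∧ r) (nz-at k) (cong₂ _<ʳᵇ_ (B-at k k≤) (A-at k k≤)) ⟩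
        Bˢ k <ʳᵇ Aˢ k                          ≡⟨ <[]-does (B<[γ]A k) ⟩
        γ k                                    ∎

      bottom-rung : ∀ k → k ≤ suc L → (A (s + k) <ʳᵇ B (s + k)) ≡ not (γ k)
      bottom-rung k k≤ = trans (cong₂ _<ʳᵇ_ (A-at k k≤) (B-at k k≤)) (<[]-does (<[]-flip (B<[γ]A k)))

      bottom-left : ∀ k → k ≤ suc L → (nz (prv (s + k)) ∧ (B (prv (s + k)) <ʳᵇ B (s + k))) ≡ β k
      bottom-left zero _ = subst (λ j → (nz (prv j) ∧ (B (prv j) <ʳᵇ B j)) ≡ β₀) (sym (+-identityʳ s)) left-bottom
      bottom-left (suc k) (s≤s k≤L) = begin
        nz (prv (s + suc k)) ∧ (B (prv (s + suc k)) <ʳᵇ B (s + suc k))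
          ≡⟨ cong₂ (λ i j → nz i ∧ (B i <ʳᵇ B j)) (prv-at k) (+-suc s k) ⟩
        nz (s + k) ∧ (B (s + k) <ʳᵇ B (suc (s + k)))
          ≡⟨ cong₂ (λ z r → z ∧ r) (nz-at k) (cong₂ _<ʳᵇ_ (B-at k (≤suc k≤L)) (B-next k k≤L)) ⟩
        Bˢ k <ʳᵇ Bˢ (suc k)
          ≡⟨ <[]-does (B-step k) ⟩
        β (suc k) ∎

      bottom-right : ∀ k → k ≤ L → (nz (nxt (s + k)) ∧ (B (nxt (s + k)) <ʳᵇ B (s + k))) ≡ not (β (suc k))
      bottom-right k k≤L = begin
        nz (nxt (s + k)) ∧ (B (nxt (s + k)) <ʳᵇ B (s + k))
          ≡⟨ cong (λ i → nz i ∧ (B i <ʳᵇ B (s + k))) (nxt-at k k≤L) ⟩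
        nz (s + suc k) ∧ (B (s + suc k) <ʳᵇ B (s + k))
          ≡⟨ cong₂ (λ z r → z ∧ r) (nz-at (suc k)) (cong₂ _<ʳᵇ_ (B-at (suc k) (s≤s k≤L)) (B-at k (≤suc k≤L))) ⟩
        Bˢ (suc k) <ʳᵇ Bˢ k
          ≡⟨ <[]-does (<[]-flip (B-step k)) ⟩
        not (β (suc k)) ∎

      interior-top : ∀ k → k ≤ L → topIn A B (s + k) ≡ X (s + k)
      interior-top k k≤L = begin
        topIn A B (s + k)
          ≡⟨ cong₂ _xor_ (top-left k (≤suc k≤L)) (cong₂ _xor_ (top-right k k≤L) (top-rung k (≤suc k≤L))) ⟩
        α k xor not (α (suc k)) xor γ k
          ≡⟨ top-parity k ⟩
        X (s + k)                          ∎

      interior-bottom : ∀ k → k ≤ L → bottomIn A B (s + k) ≡ Y (s + k)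
      interior-bottom k k≤L = begin
        bottomIn A B (s + k)
          ≡⟨ cong₂ _xor_ (bottom-rung k (≤suc k≤L)) (cong₂ _xor_ (bottom-left k (≤suc k≤L)) (bottom-right k k≤L)) ⟩
        not (γ k) xor β k xor not (β (suc k))
          ≡⟨ bottom-parity k ⟩
        Y (s + k)                                ∎

      interior-top-comparable : ∀ k → k ≤ L → Comparable (A (s + k)) (A (nxt (s + k)))
      interior-top-comparable k k≤L rewrite A-at k (≤suc k≤L) | nxt-at k k≤L | A-at (suc k) (s≤s k≤L) =
        <[]-comparable (A-step k)

      scan-rung-comparable : ∀ k → k ≤ suc L → Comparable (A (s + k)) (B (s + k))
      scan-rung-comparable k k≤ rewrite A-at k k≤ | B-at k k≤ = <[]-comparable (<[]-flip (B<[γ]A k))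

      interior-bottom-comparable : ∀ k → k ≤ L → Comparable (B (s + k)) (B (suc (s + k)))
      interior-bottom-comparable k k≤L rewrite B-at k (≤suc k≤L) | B-next k k≤L = <[]-comparable (B-step k)

module Constructions (m : ℕ) (X Y : ℕ → Bool) where
  open Coordinates (suc m)
  open Solutions (suc m)

  private
    mode-B : ∀ b y → not (not (b xor y)) xor b xor false ≡ y
    mode-B true  true  = refl
    mode-B true  false = refl
    mode-B false true  = refl
    mode-B false false = refl

    xor-xor-cancel : ∀ a b y → a xor b xor (a xor b xor y) ≡ y
    xor-xor-cancel true  true  true  = refl
    xor-xor-cancel true  true  false = refl
    xor-xor-cancel true  false true  = refl
    xor-xor-cancel true  false false = refl
    xor-xor-cancel false true  true  = refl
    xor-xor-cancel false true  false = refl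
    xor-xor-cancel false false true  = refl
    xor-xor-cancel false false false = refl

    xor-thrice : ∀ x → x xor x xor x ≡ x
    xor-thrice true  = refl
    xor-thrice false = refl

    xor-not-self : ∀ x → x xor not x xor false ≡ true
    xor-not-self true  = refl
    xor-not-self false = refl

    not-xor-self : ∀ x → not x xor x xor false ≡ true
    not-xor-self true  = refl
    not-xor-self false = refl

    b₁-identity : ∀ x y → not x xor false xor not (not (y xor not x)) ≡ y
    b₁-identity true  true  = refl
    b₁-identity true  false = refl
    b₁-identity false true  = refl
    b₁-identity false false = refl

    twice-not : ∀ a → not a xor not a xor false ≡ false
    twice-not true  = refl
    twice-not false = refl

    xor-around : ∀ a r → a xor r xor a ≡ r
    xor-around true  true  = refl
    xor-around true  false = refl
    xor-around false true  = refl
    xor-around false false = refl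

  -- τ(t₀) even: t₀ is a source or a sink and the scan covers the columns 1 … n.
  module ExtremeT₀ (X₀≡false : X 0 ≡ false) where
    open Embedding (suc m) X Y 1 (X 1) false (suc m) (λ _ β → not (β xor Y n))
    open Within (s≤s z≤n) ≤-refl

    t₀ : Rank
    t₀ = extreme (not (X 1)) n , + 0

    A B : ℕ → Rank
    A zero    = t₀
    A (suc k) = Aˢ k
    B zero    = t₀
    B (suc k) = Bˢ k

    private
      primary≤ : ∀ k → k ≤ suc (suc m) → ∣ proj₁ (Aˢ k) ∣ ≤ n
      primary≤ k k≤ = proj₁ (proj₁ (scan-bounded k k≤))

      t₀<[X₁] : ∀ k → k ≤ suc (suc m) → t₀ <[ X 1 ] Aˢ k
      t₀<[X₁] k k≤ = from-extreme₁ (X 1) (+ 0) (primary≤ k k≤)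

    open Interior A B (λ _ _ → refl) (λ _ _ → refl) (<[]-does (t₀<[X₁] 0 z≤n)) refl

    private
      bottom-end : bottomIn A B n ≡ not (γ (suc (suc m))) xor β (suc (suc m)) xor false
      bottom-end = cong₂ _xor_ (bottom-rung (suc (suc m)) ≤-refl)
                               (cong₂ _xor_ (bottom-left (suc (suc m)) ≤-refl) (cong (λ j → nz j ∧ (B j <ʳᵇ B n)) nxt-last))

      end : bottomIn A B n ≡ Y n
      end = [ (λ γ≡final → trans bottom-end (trans (cong (λ g → not g xor β (suc (suc m)) xor false) γ≡final)
                                                    (mode-B (β (suc (suc m))) (Y n))))
            , (λ forced → contradiction refl (proj₁ (forcedChain-start (suc m) (proj₁ forced)))) ]′ last-rung

      t₀-equation : topIn A B 0 ≡ X 0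
      t₀-equation = begin
        (Aˢ (suc (suc m)) <ʳᵇ t₀) xor (Aˢ 0 <ʳᵇ t₀) xor false
          ≡⟨ cong₂ (λ a b → a xor b xor false) (<[]-does (<[]-flip (t₀<[X₁] (suc (suc m)) ≤-refl)))
                                               (<[]-does (<[]-flip (t₀<[X₁] 0 z≤n))) ⟩
        not (X 1) xor not (X 1) xor false
          ≡⟨ cong (not (X 1) xor_) (xor-identityʳ (not (X 1))) ⟩
        not (X 1) xor not (X 1)
          ≡⟨ xor-same (not (X 1)) ⟩
        false
          ≡⟨ sym X₀≡false ⟩
        X 0 ∎

      top-comparable′ : ∀ j → j ≤ n → Comparable (A j) (A (nxt j))
      top-comparable′ zero    _      = <[]-comparable (t₀<[X₁] 0 z≤n)
      top-comparable′ (suc k) k+1≤n with m≤n⇒m<n∨m≡n k+1≤n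
      ... | inj₁ (s≤s (s≤s k≤L)) = interior-top-comparable k k≤L
      ... | inj₂ refl = subst (λ j → Comparable (A n) (A j)) (sym nxt-last)
                              (<[]-comparable (<[]-flip (t₀<[X₁] (suc (suc m)) ≤-refl)))

    solution : Solution X Y
    solution = record
      { A                 = A
      ; B                 = B
      ; top-comparable    = top-comparable′
      ; rung-comparable   = λ { (suc k) _ (s≤s k≤) → scan-rung-comparable k k≤ }
      ; bottom-comparable = λ { (suc k) _ (s≤s (s≤s k≤L)) → interior-bottom-comparable k k≤L }
      ; top-parity        = λ { zero _ → t₀-equation ; (suc k) (s≤s (s≤s k≤L)) → interior-top k k≤L }
      ; bottom-parity     = λ { (suc k) _ (s≤s (s≤s k≤L)) → interior-bottom k k≤L }
      ; last-column       = inj₂ end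
      }

  -- τ(t₀) odd, first attempt: t₁ is a source or a sink with t₀ right next to it, the scan covers the columns 2 … n
  -- and b₁ is ranked right next to b₂.
  module T₀BesideT₁ (X₀≡true : X 0 ≡ true) where
    β₀ : Bool
    β₀ = not (Y 1 xor not (X 1))

    open Embedding (suc m) X Y 2 (not (X 1)) β₀ m (λ _ β → not (β xor Y n))
    open Within (s≤s z≤n) ≤-refl

    t₀ t₁ b₁ : Rank
    t₀ = extreme (X 1) n , + 0
    t₁ = extreme (X 1) n , extreme (X 1) 0
    b₁ = proj₁ (Bˢ 0) , extreme (not β₀) n

    A B : ℕ → Rank
    A zero          = t₀
    A (suc zero)    = t₁
    A (suc (suc k)) = Aˢ k
    B zero          = t₀
    B (suc zero)    = b₁
    B (suc (suc k)) = Bˢ k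

    private
      below-t₀ : ∀ k → k ≤ suc m → Aˢ k <[ X 1 ] t₀
      below-t₀ k k≤ = to-extreme₁ (X 1) (+ 0) (proj₁ (proj₁ (scan-bounded k k≤)))

      below-t₁ : ∀ k → k ≤ suc m → Aˢ k <[ X 1 ] t₁
      below-t₁ k k≤ = to-extreme₁ (X 1) (extreme (X 1) 0) (proj₁ (proj₁ (scan-bounded k k≤)))

      t₀<t₁ : t₀ <[ X 1 ] t₁
      t₀<t₁ = to-extreme₂ (X 1) (extreme (X 1) n) z≤n

      b₁<t₁ : b₁ <[ X 1 ] t₁
      b₁<t₁ = to-extreme₁ (X 1) (extreme (X 1) 0) (proj₁ (proj₂ (scan-bounded 0 z≤n)))

      b₁<b₂ : b₁ <[ β₀ ] Bˢ 0
      b₁<b₂ = from-extreme₂ β₀ (proj₁ (Bˢ 0)) (proj₂ (proj₂ (scan-bounded 0 z≤n)))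

    open Interior A B (λ _ _ → refl) (λ _ _ → refl) (<[]-does (<[]-flip (below-t₁ 0 z≤n))) (<[]-does b₁<b₂)

    private
      t₀-equation : topIn A B 0 ≡ X 0
      t₀-equation = begin
        (Aˢ (suc m) <ʳᵇ t₀) xor (t₁ <ʳᵇ t₀) xor false
          ≡⟨ cong₂ (λ a b → a xor b xor false) (<[]-does (below-t₀ (suc m) ≤-refl)) (<[]-does (<[]-flip t₀<t₁)) ⟩
        X 1 xor not (X 1) xor false
          ≡⟨ xor-not-self (X 1) ⟩
        true
          ≡⟨ sym X₀≡true ⟩
        X 0 ∎

      t₁-equation : topIn A B 1 ≡ X 1
      t₁-equation = begin
        (t₀ <ʳᵇ t₁) xor (Aˢ 0 <ʳᵇ t₁) xor (b₁ <ʳᵇ t₁)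
          ≡⟨ cong₂ _xor_ (<[]-does t₀<t₁) (cong₂ _xor_ (<[]-does (below-t₁ 0 z≤n)) (<[]-does b₁<t₁)) ⟩
        X 1 xor X 1 xor X 1
          ≡⟨ xor-thrice (X 1) ⟩
        X 1 ∎

      b₁-equation : bottomIn A B 1 ≡ Y 1
      b₁-equation = begin
        (t₁ <ʳᵇ b₁) xor false xor (Bˢ 0 <ʳᵇ b₁)
          ≡⟨ cong₂ (λ a b → a xor false xor b) (<[]-does (<[]-flip b₁<t₁)) (<[]-does (<[]-flip b₁<b₂)) ⟩
        not (X 1) xor false xor not (not (Y 1 xor not (X 1)))
          ≡⟨ b₁-identity (X 1) (Y 1) ⟩
        Y 1 ∎

      top-comparable′ : ∀ j → j ≤ n → Comparable (A j) (A (nxt j))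
      top-comparable′ zero          _ = <[]-comparable t₀<t₁
      top-comparable′ (suc zero)    _ = <[]-comparable (<[]-flip (below-t₁ 0 z≤n))
      top-comparable′ (suc (suc k)) k+2≤n with m≤n⇒m<n∨m≡n k+2≤n
      ... | inj₁ (s≤s (s≤s (s≤s k≤m))) = interior-top-comparable k k≤m
      ... | inj₂ refl = subst (λ j → Comparable (A n) (A j)) (sym nxt-last) (<[]-comparable (below-t₀ (suc m) ≤-refl))

      rung-comparable′ : ∀ j → 1 ≤ j → j ≤ n → Comparable (A j) (B j)
      rung-comparable′ (suc zero)    _ _                  = <[]-comparable (<[]-flip b₁<t₁)
      rung-comparable′ (suc (suc k)) _ (s≤s (s≤s k≤m+1)) = scan-rung-comparable k k≤m+1

      bottom-comparable′ : ∀ j → 1 ≤ j → j < n → Comparable (B j) (B (suc j))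
      bottom-comparable′ (suc zero)    _ _                        = <[]-comparable b₁<b₂
      bottom-comparable′ (suc (suc k)) _ (s≤s (s≤s (s≤s k≤m))) = interior-bottom-comparable k k≤m

      bottom-end : bottomIn A B n ≡ not (γ (suc m)) xor β (suc m) xor false
      bottom-end = cong₂ _xor_ (bottom-rung (suc m) ≤-refl)
                               (cong₂ _xor_ (bottom-left (suc m) ≤-refl) (cong (λ j → nz j ∧ (B j <ʳᵇ B n)) nxt-last))

    solution : bottomIn A B n ≡ Y n → Solution X Y
    solution end = record
      { A                 = A
      ; B                 = B
      ; top-comparable    = top-comparable′
      ; rung-comparable   = rung-comparable′
      ; bottom-comparable = bottom-comparable′
      ; top-parity        = λ { zero _ → t₀-equation ; (suc zero) _ → t₁-equation
                              ; (suc (suc k)) (s≤s (s≤s (s≤s k≤m))) → interior-top k k≤m }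
      ; bottom-parity     = λ { (suc zero) _ _ → b₁-equation
                              ; (suc (suc k)) _ (s≤s (s≤s (s≤s k≤m))) → interior-bottom k k≤m }
      ; last-column       = inj₂ end
      }

    end-or-chain : bottomIn A B n ≡ Y n ⊎
                   ForcedChain (λ k → X (2 + k)) (λ k → Y (2 + k)) (not (X 1)) β₀ m × Y n ≡ true
    end-or-chain = [ (λ γ≡final → inj₁ (trans bottom-end (trans (cong (λ g → not g xor β (suc m) xor false) γ≡final)
                                                                (mode-B (β (suc m)) (Y n)))))
                   , forced-case ]′ last-rung
      where
      forced-case : ForcedChain (λ k → X (2 + k)) (λ k → Y (2 + k)) (not (X 1)) β₀ m ×
                    γ (suc m) ≡ α (suc m) × β (suc m) ≡ not (α (suc m)) →
                    bottomIn A B n ≡ Y n ⊎ ForcedChain (λ k → X (2 + k)) (λ k → Y (2 + k)) (not (X 1)) β₀ m × Y n ≡ true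
      forced-case (chain , γ≡α , β≡¬α) =
        [ (λ Yₙ≡false → inj₁ (trans bottom-end (trans (cong₂ (λ g b → not g xor b xor false) γ≡α β≡¬α)
                                                      (trans (twice-not (α (suc m))) (sym Yₙ≡false)))))
        , (λ Yₙ≡true → inj₂ (chain , Yₙ≡true)) ]′ (dichotomy (Y n))

  -- τ(t₀) odd, second attempt, the mirror image: tₙ is extreme, the scan covers the columns 1 … n − 1 and bₙ is
  -- ranked right next to bₙ₋₁.
  module T₀BesideTₙ (X₀≡true : X 0 ≡ true) where
    open Embedding (suc m) X Y 1 (not (X n)) false m (λ α _ → α xor not (X n) xor X (suc (suc m)))
    open Within (s≤s z≤n) (n≤1+n (suc (suc m)))

    r : Bool
    r = not (γ (suc m)) xor β (suc m) xor Y (suc (suc m))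

    t₀ tₙ bₙ : Rank
    t₀ = extreme (X n) n , + 0
    tₙ = extreme (X n) n , extreme (X n) 0
    bₙ = proj₁ (Bˢ (suc m)) , extreme (not r) n

    A B : ℕ → Rank
    A zero    = t₀
    A (suc k) = if k ≡ᵇ suc (suc m) then tₙ else Aˢ k
    B zero    = t₀
    B (suc k) = if k ≡ᵇ suc (suc m) then bₙ else Bˢ k

    private
      before-last : ∀ {k} → k ≤ suc m → (k ≡ᵇ suc (suc m)) ≡ false
      before-last {k} k≤ = ≢⇒≡ᵇ-false {k} {suc (suc m)} (λ { refl → <-irrefl refl k≤ })

      A-at : ∀ k → k ≤ suc m → A (suc k) ≡ Aˢ k
      A-at k k≤ = if-false (before-last k≤)

      B-at : ∀ k → k ≤ suc m → B (suc k) ≡ Bˢ k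
      B-at k k≤ = if-false (before-last k≤)

      A-n : A n ≡ tₙ
      A-n = if-true (≡ᵇ-refl (suc (suc m)))

      B-n : B n ≡ bₙ
      B-n = if-true (≡ᵇ-refl (suc (suc m)))

      below-t₀ : ∀ k → k ≤ suc m → Aˢ k <[ X n ] t₀
      below-t₀ k k≤ = to-extreme₁ (X n) (+ 0) (proj₁ (proj₁ (scan-bounded k k≤)))

      below-tₙ : ∀ k → k ≤ suc m → Aˢ k <[ X n ] tₙ
      below-tₙ k k≤ = to-extreme₁ (X n) (extreme (X n) 0) (proj₁ (proj₁ (scan-bounded k k≤)))

      t₀<tₙ : t₀ <[ X n ] tₙ
      t₀<tₙ = to-extreme₂ (X n) (extreme (X n) n) z≤n

      bₙ<tₙ : bₙ <[ X n ] tₙ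
      bₙ<tₙ = to-extreme₁ (X n) (extreme (X n) 0) (proj₁ (proj₂ (scan-bounded (suc m) ≤-refl)))

      bₙ<bₙ₋₁ : bₙ <[ r ] Bˢ (suc m)
      bₙ<bₙ₋₁ = from-extreme₂ r (proj₁ (Bˢ (suc m))) (proj₂ (proj₂ (scan-bounded (suc m) ≤-refl)))

    open Interior A B A-at B-at (<[]-does (<[]-flip (below-t₀ 0 z≤n))) refl

    private
      t₀-equation : topIn A B 0 ≡ X 0
      t₀-equation = begin
        (A n <ʳᵇ t₀) xor (Aˢ 0 <ʳᵇ t₀) xor false
          ≡⟨ cong₂ (λ a b → a xor b xor false) (trans (cong (_<ʳᵇ t₀) A-n) (<[]-does (<[]-flip t₀<tₙ)))
                                               (<[]-does (below-t₀ 0 z≤n)) ⟩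
        not (X n) xor X n xor false
          ≡⟨ not-xor-self (X n) ⟩
        true
          ≡⟨ sym X₀≡true ⟩
        X 0 ∎

      tₙ-equation : topIn A B n ≡ X n
      tₙ-equation = begin
        (A (suc (suc m)) <ʳᵇ A n) xor (A (nxt n) <ʳᵇ A n) xor (B n <ʳᵇ A n)
          ≡⟨ cong₃′ ⟩
        (Aˢ (suc m) <ʳᵇ tₙ) xor (t₀ <ʳᵇ tₙ) xor (bₙ <ʳᵇ tₙ)
          ≡⟨ cong₂ _xor_ (<[]-does (below-tₙ (suc m) ≤-refl)) (cong₂ _xor_ (<[]-does t₀<tₙ) (<[]-does bₙ<tₙ)) ⟩
        X n xor X n xor X n
          ≡⟨ xor-thrice (X n) ⟩
        X n ∎
        where
        cong₃′ : (A (suc (suc m)) <ʳᵇ A n) xor (A (nxt n) <ʳᵇ A n) xor (B n <ʳᵇ A n) ≡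
                 (Aˢ (suc m) <ʳᵇ tₙ) xor (t₀ <ʳᵇ tₙ) xor (bₙ <ʳᵇ tₙ)
        cong₃′ = cong₂ _xor_ (cong₂ _<ʳᵇ_ (A-at (suc m) ≤-refl) A-n)
                             (cong₂ _xor_ (cong₂ _<ʳᵇ_ (cong A nxt-last) A-n) (cong₂ _<ʳᵇ_ B-n A-n))

      tₙ₋₁-value : topIn A B (suc (suc m)) ≡ α (suc m) xor not (X n) xor γ (suc m)
      tₙ₋₁-value = cong₂ _xor_ (top-left (suc m) ≤-refl) (cong₂ _xor_ right (top-rung (suc m) ≤-refl))
        where
        right : (A (nxt (suc (suc m))) <ʳᵇ A (suc (suc m))) ≡ not (X n)
        right = trans (cong₂ _<ʳᵇ_ (trans (cong A (nxt-below (suc (suc m)) ≤-refl)) A-n) (A-at (suc m) ≤-refl))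
                      (<[]-does (<[]-flip (below-tₙ (suc m) ≤-refl)))

      bₙ₋₁-equation : bottomIn A B (suc (suc m)) ≡ Y (suc (suc m))
      bₙ₋₁-equation = begin
        bottomIn A B (suc (suc m))
          ≡⟨ cong₂ _xor_ (bottom-rung (suc m) ≤-refl) (cong₂ _xor_ (bottom-left (suc m) ≤-refl) right) ⟩
        not (γ (suc m)) xor β (suc m) xor r
          ≡⟨ xor-xor-cancel (not (γ (suc m))) (β (suc m)) (Y (suc (suc m))) ⟩
        Y (suc (suc m)) ∎
        where
        right : (nz (nxt (suc (suc m))) ∧ (B (nxt (suc (suc m))) <ʳᵇ B (suc (suc m)))) ≡ r
        right = trans (cong (λ j → nz j ∧ (B j <ʳᵇ B (suc (suc m)))) (nxt-below (suc (suc m)) ≤-refl))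
                      (trans (cong₂ _<ʳᵇ_ B-n (B-at (suc m) ≤-refl)) (<[]-does bₙ<bₙ₋₁))

      up-to-last : ∀ {k} → k ≤ suc m → k ≤ m ⊎ k ≡ suc m
      up-to-last k≤m+1 with m≤n⇒m<n∨m≡n k≤m+1
      ... | inj₁ (s≤s k≤m) = inj₁ k≤m
      ... | inj₂ refl      = inj₂ refl

      top-comparable′ : ∀ j → j ≤ n → Comparable (A j) (A (nxt j))
      top-comparable′ zero _ = <[]-comparable (<[]-flip (below-t₀ 0 z≤n))
      top-comparable′ (suc k) (s≤s k≤m+2) with m≤n⇒m<n∨m≡n k≤m+2
      ... | inj₂ refl = subst₂ Comparable (sym A-n) (sym (cong A nxt-last)) (<[]-comparable (<[]-flip t₀<tₙ))
      ... | inj₁ (s≤s k≤m+1) with up-to-last k≤m+1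
      ...   | inj₁ k≤m = interior-top-comparable k k≤m
      ...   | inj₂ refl = subst₂ Comparable (sym (A-at (suc m) ≤-refl))
                                            (sym (trans (cong A (nxt-below (suc (suc m)) ≤-refl)) A-n))
                                            (<[]-comparable (below-tₙ (suc m) ≤-refl))

      rung-comparable′ : ∀ j → 1 ≤ j → j ≤ n → Comparable (A j) (B j)
      rung-comparable′ (suc k) _ (s≤s k≤m+2) with m≤n⇒m<n∨m≡n k≤m+2
      ... | inj₁ (s≤s k≤m+1) = scan-rung-comparable k k≤m+1
      ... | inj₂ refl = subst₂ Comparable (sym A-n) (sym B-n) (<[]-comparable (<[]-flip bₙ<tₙ))

      bottom-comparable′ : ∀ j → 1 ≤ j → j < n → Comparable (B j) (B (suc j))
      bottom-comparable′ (suc k) _ (s≤s (s≤s k≤m+1)) with up-to-last k≤m+1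
      ... | inj₁ k≤m = interior-bottom-comparable k k≤m
      ... | inj₂ refl = subst₂ Comparable (sym (B-at (suc m) ≤-refl)) (sym B-n) (<[]-comparable (<[]-flip bₙ<bₙ₋₁))

    solution : topIn A B (suc (suc m)) ≡ X (suc (suc m)) → Solution X Y
    solution end = record
      { A                 = A
      ; B                 = B
      ; top-comparable    = top-comparable′
      ; rung-comparable   = rung-comparable′
      ; bottom-comparable = bottom-comparable′
      ; top-parity        = top-parity′
      ; bottom-parity     = bottom-parity′
      ; last-column       = inj₁ tₙ-equation
      }
      where
      top-parity′ : ∀ j → j < n → topIn A B j ≡ X j
      top-parity′ zero _ = t₀-equation
      top-parity′ (suc k) (s≤s (s≤s k≤m+1)) with up-to-last k≤m+1
      ... | inj₁ k≤m = interior-top k k≤m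
      ... | inj₂ refl = end

      bottom-parity′ : ∀ j → 1 ≤ j → j < n → bottomIn A B j ≡ Y j
      bottom-parity′ (suc k) _ (s≤s (s≤s k≤m+1)) with up-to-last k≤m+1
      ... | inj₁ k≤m = interior-bottom k k≤m
      ... | inj₂ refl = bₙ₋₁-equation

    end-or-chain : topIn A B (suc (suc m)) ≡ X (suc (suc m)) ⊎
                   ForcedChain (λ k → X (1 + k)) (λ k → Y (1 + k)) (not (X n)) false m × X (suc (suc m)) ≡ X n
    end-or-chain = [ (λ γ≡final → inj₁ (trans tₙ₋₁-value (trans (cong (λ g → α (suc m) xor not (X n) xor g) γ≡final)
                                                                 (xor-xor-cancel (α (suc m)) (not (X n)) (X (suc (suc m)))))))
                   , forced-case ]′ last-rung
      where
      forced-case : ForcedChain (λ k → X (1 + k)) (λ k → Y (1 + k)) (not (X n)) false m ×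
                    γ (suc m) ≡ α (suc m) × β (suc m) ≡ not (α (suc m)) →
                    topIn A B (suc (suc m)) ≡ X (suc (suc m)) ⊎
                    ForcedChain (λ k → X (1 + k)) (λ k → Y (1 + k)) (not (X n)) false m × X (suc (suc m)) ≡ X n
      forced-case (chain , γ≡α , _) with X (suc (suc m)) Boolₚ.≟ X n
      ... | yes Xₙ₋₁≡Xₙ = inj₂ (chain , Xₙ₋₁≡Xₙ)
      ... | no  Xₙ₋₁≢Xₙ = inj₁ (trans tₙ₋₁-value (trans (cong (λ g → α (suc m) xor not (X n) xor g) γ≡α)
                                (trans (xor-around (α (suc m)) (not (X n))) (sym (¬-not Xₙ₋₁≢Xₙ)))))

module Theorem (m : ℕ) (τ : GV (suc (suc (suc (suc m)))) → Bool) where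

  open Coordinates (suc m)

  G : FinGraph
  G = G12 (suc n)

  X Y : ℕ → Bool
  X k = byCoordinates τ k zero
  Y k = byCoordinates τ k (suc zero)

  open Constructions m X Y
  open Solutions (suc m)

  FailureBesideT₁ : Set
  FailureBesideT₁ = ForcedChain (λ k → X (2 + k)) (λ k → Y (2 + k)) (not (X 1)) (not (Y 1 xor not (X 1))) m × Y n ≡ true

  FailureBesideTₙ : Set
  FailureBesideTₙ = ForcedChain (λ k → X (1 + k)) (λ k → Y (1 + k)) (not (X n)) false m × X (suc (suc m)) ≡ X n

  orientation : CondP G τ → (X 0 ≡ true → FailureBesideT₁ → FailureBesideTₙ → ⊥) → AcyclicTOddOrientation G τ
  orientation condP exceptional with dichotomy (X 0)
  ... | inj₁ X₀≡false = solution-orientation τ condP (ExtremeT₀.solution X₀≡false)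
  ... | inj₂ X₀≡true  =
    [ (λ end → solution-orientation τ condP (T₀BesideT₁.solution X₀≡true end))
    , (λ failure₁ → [ (λ end → solution-orientation τ condP (T₀BesideTₙ.solution X₀≡true end))
                    , (λ failure₂ → ⊥-elim (exceptional X₀≡true failure₁ failure₂))
                    ]′ (T₀BesideTₙ.end-or-chain X₀≡true))
    ]′ (T₀BesideT₁.end-or-chain X₀≡true)

  failure-even : FailureBesideT₁ → 2 ∣ suc n
  failure-even (chain , _) = ∣m∣n⇒∣m+n ∣-refl (∣m∣n⇒∣m+n ∣-refl (forcedChain-even m chain))

  module Exceptional (X₀≡true : X 0 ≡ true) (failure₁ : FailureBesideT₁) (failure₂ : FailureBesideTₙ) where

    private
      start₁ : ForcedChain (λ k → X (2 + k)) (λ k → Y (2 + k)) (not (X 1)) (not (Y 1 xor not (X 1))) 0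
      start₁ = forcedChain-start m (proj₁ failure₁)

      start₂ : ForcedChain (λ k → X (1 + k)) (λ k → Y (1 + k)) (not (X n)) false 0
      start₂ = forcedChain-start m (proj₁ failure₂)

      X₁≡X₂ : X 1 ≡ X 2
      X₁≡X₂ = not-injective (¬-not (proj₁ start₁))

      Xₙ≡X₁ : X n ≡ X 1
      Xₙ≡X₁ = not-injective (¬-not (proj₁ start₂))

      Y₁≡true : Y 1 ≡ true
      Y₁≡true = forces-true (X 1) (Y 1) (subst (λ x → (X 1 xor Y 1) xor (not x xor false) ≡ false) Xₙ≡X₁ (proj₂ start₂))
        where forces-true : ∀ x y → (x xor y) xor (not x xor false) ≡ false → y ≡ true
              forces-true true  true  _ = refl
              forces-true false true  _ = refl

      Y₂≡X₁ : Y 2 ≡ X 1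
      Y₂≡X₁ = forces-x (X 1) (Y 2) (subst₂ (λ x y → (x xor Y 2) xor (not (X 1) xor not (y xor not (X 1))) ≡ false)
                                           (sym X₁≡X₂) Y₁≡true (proj₂ start₁))
        where forces-x : ∀ x y → (x xor y) xor (not x xor not (true xor not x)) ≡ false → y ≡ x
              forces-x true  true  _ = refl
              forces-x false false _ = refl

      steady : ∀ j → j ≤ m → X (2 + j) ≡ X 2 × Y (2 + j) ≡ Y 2
      steady zero    _       = refl , refl
      steady (suc j) j+1≤m with interleave {X} {Y} m (proj₁ failure₁) (proj₁ failure₂) (suc j) (s≤s z≤n) j+1≤m
      ... | X-step , Y-step = trans (sym X-step) (proj₁ (steady j (≤-trans (n≤1+n j) j+1≤m))) ,
                              trans (sym Y-step) (proj₂ (steady j (≤-trans (n≤1+n j) j+1≤m)))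

      top-value : ∀ k → 1 ≤ k → k ≤ n → X k ≡ X 1
      top-value (suc zero)    _ _ = refl
      top-value (suc (suc j)) _ (s≤s j+1≤m+2) with m≤n⇒m<n∨m≡n j+1≤m+2
      ... | inj₁ (s≤s (s≤s j≤m)) = trans (proj₁ (steady j j≤m)) (sym X₁≡X₂)
      ... | inj₂ refl             = Xₙ≡X₁

      bottom-value : ∀ k → 1 ≤ k → k ≤ n → Y k ≡ X 1 ∨ not (true xor nz (prv k) xor nz (nxt k))
      bottom-value (suc zero) _ _ = trans Y₁≡true (sym (∨-zeroʳ (X 1)))
      bottom-value (suc (suc j)) _ (s≤s j+1≤m+2) with m≤n⇒m<n∨m≡n j+1≤m+2
      ... | inj₁ (s≤s (s≤s j≤m)) =
        trans (proj₂ (steady j j≤m))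
              (trans Y₂≡X₁ (trans (sym (∨-identityʳ (X 1)))
                                  (cong (λ k → X 1 ∨ not (true xor true xor nz k))
                                        (sym (nxt-below (suc (suc j)) (s≤s (s≤s (s≤s j≤m))))))))
      ... | inj₂ refl =
        trans (proj₂ failure₁) (trans (sym (∨-zeroʳ (X 1))) (cong (λ k → X 1 ∨ not (true xor true xor nz k)) (sym nxt-last)))

    exceptional-τ : ∀ v → τ v ≡ X 1 ∨ not (isOdd G (deg G v))
    exceptional-τ v@((i , zero) , pf) =
      trans (byCoordinates-correct τ v)
            (trans (top (toℕ i) (col≤n v)) (cong (λ o → X 1 ∨ not o) (sym (top-degree i pf))))
      where
      top : ∀ k → k ≤ n → X k ≡ X 1 ∨ not (nz k)
      top zero    _   = trans X₀≡true (sym (∨-zeroʳ (X 1)))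
      top (suc k) k<n = trans (top-value (suc k) (s≤s z≤n) k<n) (sym (∨-identityʳ (X 1)))
    exceptional-τ v@((i , suc zero) , pf) =
      trans (byCoordinates-correct τ v)
            (trans (bottom-value (toℕ i) (col-bottom i pf) (col≤n v))
                   (cong (λ o → X 1 ∨ not o) (sym (bottom-degree i pf))))

    private
      τ-with : ∀ {x} → X 1 ≡ x → ∀ v → τ v ≡ x ∨ not (isOdd G (deg G v))
      τ-with X₁≡x v = trans (exceptional-τ v) (cong (_∨ not (isOdd G (deg G v))) X₁≡x)

      no-sink : ∀ {t o} → t ≡ not o → (t ∧ o) ∨ (not t ∧ not o) ≡ false
      no-sink {o = true}  refl = refl
      no-sink {o = false} refl = refl

    no-source-or-no-sink : CondS G τ → CondSbar G τ → ⊥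
    no-source-or-no-sink (source≢0 , _) (sink≢0 , _) with dichotomy (X 1)
    ... | inj₂ X₁≡true  = source≢0 (count-false G (Source G τ) (λ v → cong not (τ-with X₁≡true v)))
    ... | inj₁ X₁≡false = sink≢0 (count-false G (Sink G τ) (λ v → no-sink (τ-with X₁≡false v)))

lemma12 : (p : ℕ) → 4 ≤ p →
    ((¬ (2 ∣ p) → (τ : GV p → Bool) → CondP (G12 p) τ →
        AcyclicTOddOrientation (G12 p) τ) ×
     (2 ∣ p → (τ : GV p → Bool) → CondP (G12 p) τ → CondS (G12 p) τ → CondSbar (G12 p) τ →
        AcyclicTOddOrientation (G12 p) τ))
lemma12 (suc (suc (suc (suc m)))) (s≤s (s≤s (s≤s (s≤s z≤n)))) =
  (λ p-odd τ condP → Theorem.orientation m τ condP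
                       (λ _ failure₁ _ → p-odd (Theorem.failure-even m τ failure₁))) ,
  (λ _ τ condP condS condS̄ → Theorem.orientation m τ condP
                               (λ X₀ failure₁ failure₂ →
                                  Theorem.Exceptional.no-source-or-no-sink m τ X₀ failure₁ failure₂ condS condS̄))
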